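{- Let $m \ge 3$ and $r \ge 1$ be integers and let $Wb(m,r)$ be the web graph. Then \[\operatorname{Z}(Wb(m,r)) = \max\left\{\left\lceil \tfrac{m}{2}\right\rceil, \min\{m,2r\}\right\},\] equivalently $\operatorname{Z}(Wb(m,r)) = m$ if $m \le 2r$; $=2r$ if $\lceil m/2\rceil < 2r < m$; and $=\lceil m/2\rceil$ if $2r \le \lceil m/2\rceil$.
   Context: The web graph $Wb(m,r)$ has vertex set $\{v_{i,j} : i\in[m], j\in[r]\} \cup \{p_i : i \in [m]\}$, where $[n]=\{1,\dots,n\}$. Two distinct vertices are adjacent if and only if: they are $p_i$ and $v_{i,1}$ for some $i$; or they are $v_{i,j_1}, v_{i,j_2}$ with $|j_1-j_2|=1$; or they are $v_{i_1,j}, v_{i_2,j}$ with $|i_1-i_2|=1$ or $\{i_1,i_2\}=\{1,m\}$. Equivalently, $Wb(m,r)$ is the Cartesian product $C_m \Box P_r$ (cycle times path, vertices $v_{i,j}$) with a pendant vertex $p_i$ attached to each $v_{i,1}$. Zero forcing: each vertex is initially blue or white; a blue vertex with exactly one white neighbor may force (color blue) that neighbor; a set $B$ of initially blue vertices is a zero forcing set if repeated application of this rule eventually makes every vertex blue. $\operatorname{Z}(G)$ denotes the minimum size of a zero forcing set of $G$. -}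

module Defs where

open import Level using (0ℓ)
open import Data.Nat using (ℕ; zero; suc; _+_; _*_; _≤_; _⊔_; _⊓_; ⌈_/2⌉)
open import Data.Fin using (Fin; toℕ)
open import Data.Product using (_×_; _,_; Σ; ∃-syntax)
open import Data.Sum using (_⊎_; inj₁; inj₂)
open import Data.Empty using (⊥)
open import Data.List using (List; length)
open import Data.List.Membership.Propositional using (_∈_)
open import Data.List.Relation.Unary.Unique.Propositional using (Unique)
open import Relation.Nullary using (¬_)
open import Relation.Binary.PropositionalEquality using (_≡_; _≢_)

record Graph : Set₁ where
  field
    V   : Set
    Adj : V → V → Set

open Graph public

-- A colouring is a predicate "is blue".
data Completes (G : Graph) : (V G → Set) → Set₁ where
  done  : {S : V G → Set} → (∀ v → S v) → Completes G S
  force : {S : V G → Set} (u w : V G) →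
          S u → ¬ S w → Adj G u w →
          (∀ x → Adj G u x → x ≢ w → S x) →
          Completes G (λ v → S v ⊎ v ≡ w) →
          Completes G S

IsZFS : (G : Graph) → List (V G) → Set₁
IsZFS G B = Completes G (λ v → v ∈ B)

ZeroForcingNumber : Graph → ℕ → Set₁
ZeroForcingNumber G k =
  (Σ (List (V G)) λ B → Unique B × IsZFS G B × length B ≡ k) ×
  (∀ (B : List (V G)) → Unique B → IsZFS G B → k ≤ length B)

CycAdj : (m : ℕ) → Fin m → Fin m → Set
CycAdj m i j =
  suc (toℕ i) ≡ toℕ j ⊎ suc (toℕ j) ≡ toℕ i ⊎
  (toℕ i ≡ 0 × suc (toℕ j) ≡ m) ⊎ (toℕ j ≡ 0 × suc (toℕ i) ≡ m)

PathAdj : (r : ℕ) → Fin r → Fin r → Set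
PathAdj r j₁ j₂ = suc (toℕ j₁) ≡ toℕ j₂ ⊎ suc (toℕ j₂) ≡ toℕ j₁

-- Vertices of Wb(m,r): inj₁ (i , j) is v_{i+1,j+1}; inj₂ i is p_{i+1}.
WbV : ℕ → ℕ → Set
WbV m r = (Fin m × Fin r) ⊎ Fin m

WbAdj : (m r : ℕ) → WbV m r → WbV m r → Set
WbAdj m r (inj₂ i) (inj₂ i') = ⊥
WbAdj m r (inj₂ i) (inj₁ (i' , j)) = i ≡ i' × toℕ j ≡ 0
WbAdj m r (inj₁ (i , j)) (inj₂ i') = i ≡ i' × toℕ j ≡ 0
WbAdj m r (inj₁ (i , j)) (inj₁ (i' , j')) =
  (i ≡ i' × PathAdj r j j') ⊎ (j ≡ j' × CycAdj m i i')

Web : ℕ → ℕ → Graph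
Web m r = record { V = WbV m r ; Adj = WbAdj m r }

-- Follow the forcing process with the list of ends of the forcing chains: it has |B|
-- entries, a force replaces the forcer by the forced vertex, and the list always contains every
-- active vertex (blue with a white neighbour).  A pendant outside B is forced by its only neighbour
-- and then stays a chain end, so m ≤ 2|B|.  If B meets every column then m ≤ |B|; otherwise consider
-- the force that gives the last empty column c its first blue vertex.  If no column is entirely
-- blue, every column contains a blue and a white vertex, hence an active one, right after that
-- force: m ≤ |B|.  If column g is entirely blue and every row has a further blue vertex, each row is
-- a cycle with two blue vertices and a white one (in column c), hence with two active vertices:
-- 2r ≤ |B|.  If instead some row is white outside g, that row supplies an active vertex in every
-- column after the force: m ≤ |B|.
--
-- If m ≤ 2r, all pendants force the web level by level.  Otherwise take the pendants
-- of 2r consecutive columns a..b and of the columns b + 2, b + 4, …, b + 2e with e = ⌈m/2⌉ ∸ 2r.  The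
-- block forces a pyramid whose two top columns are full, and these fill the block sideways; each
-- extra pendant lets the filled rectangle grow by two columns; the at most r columns left on either
-- side are then forced sideways, each one from one level higher, until the top row is blue, and the
-- top row forces everything below it.

module Submission where

open import Defs
open import Data.Nat using (ℕ; _≤_; _⊔_; _⊓_; _*_; ⌈_/2⌉)
open import Data.Nat using (zero; suc; _+_; _∸_; _<_; s≤s; z≤n; z<s; _≤?_; _<?_) renaming (_≟_ to _≟ℕ_)
open import Data.Nat.Properties
open import Data.Nat.Tactic.RingSolver using (solve-∀)
open import Data.Fin using (Fin; toℕ; fromℕ<; inject₁; splitAt; join)
open import Data.Fin.Properties using (toℕ-injective; toℕ-fromℕ<; toℕ-inject₁; fromℕ<-toℕ; toℕ<n; injective⇒≤; any?; all?; ¬∀⟶∃¬; join-splitAt)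
  renaming (_≟_ to _≟ᶠ_)
open import Data.Product using (_×_; _,_; Σ; ∃-syntax; proj₁; proj₂)
open import Data.Sum using (_⊎_; inj₁; inj₂; [_,_]; [_,_]′)
import Data.Sum as Sum
import Data.Product as Product
open import Data.Sum.Properties using (inj₂-injective) renaming (≡-dec to ≡-dec⊎)
open import Data.Product.Properties using () renaming (≡-dec to ≡-dec×)
open import Data.Empty using (⊥-elim)
open import Data.List using (List; []; _∷_; _++_; length; lookup; filter; map; tabulate; allFin; cartesianProduct; _[_]∷=_)
open import Data.List.Properties using (length-∷=; length-++; length-map; length-tabulate)
open import Data.List.Relation.Unary.Unique.Propositional using (Unique)
import Data.List.Relation.Unary.Unique.Propositional.Properties as Unique
open import Data.List.Membership.Propositional using (_∈_)
open import Data.List.Membership.Propositional.Properties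
  using (∈-filter⁺; ∈-filter⁻; ∈-++⁺ˡ; ∈-++⁺ʳ; ∈-map⁺; ∈-allFin; ∈-cartesianProduct⁺; ∈-tabulate⁺; ∈-tabulate⁻)
open import Data.List.Relation.Unary.Any using (here; there; index)
open import Data.List.Relation.Unary.Any.Properties using (lookup-index)
open import Function using (id; _∘_; _⟨_⟩_)
open import Relation.Nullary using (¬_; Dec; yes; no)
open import Relation.Nullary.Decidable using (¬?; _⊎-dec_; _×-dec_; decidable-stable)
open import Relation.Unary using (Decidable; _⊆′_; _≐′_)
open import Relation.Unary.Properties using (_∪?_)
open import Relation.Binary.Definitions using (DecidableEquality)
open import Relation.Binary using (tri<; tri≈; tri>)
open import Relation.Binary.PropositionalEquality using (_≡_; _≢_; refl; sym; trans; subst; subst₂; cong; cong₂; module ≡-Reasoning)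

_∪｛_｝ : {A : Set} → (A → Set) → A → A → Set
(S ∪｛ w ｝) x = S x ⊎ x ≡ w

fin-injection⇒≤length : ∀ {A : Set} {k} (f : Fin k → A) → (∀ {s t} → f s ≡ f t → s ≡ t) →
                        (xs : List A) → (∀ t → f t ∈ xs) → k ≤ length xs
fin-injection⇒≤length f f-inj xs f∈xs = injective⇒≤ index-inj
  where
  index-inj : ∀ {s t} → index (f∈xs s) ≡ index (f∈xs t) → s ≡ t
  index-inj {s} {t} eq = f-inj (trans (lookup-index (f∈xs s)) (trans (cong (lookup xs) eq) (sym (lookup-index (f∈xs t)))))

∈-∷=⁺-updated : ∀ {A : Set} (xs : List A) k v → v ∈ xs [ k ]∷= v
∈-∷=⁺-updated (x ∷ xs) Fin.zero    v = here refl
∈-∷=⁺-updated (x ∷ xs) (Fin.suc k) v = there (∈-∷=⁺-updated xs k v)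

∈-∷=⁺-untouched : ∀ {A : Set} (xs : List A) k v {y} → y ∈ xs → y ≢ lookup xs k → y ∈ xs [ k ]∷= v
∈-∷=⁺-untouched (x ∷ xs) Fin.zero    v (here refl) y≢x = ⊥-elim (y≢x refl)
∈-∷=⁺-untouched (x ∷ xs) Fin.zero    v (there y∈)  _   = there y∈
∈-∷=⁺-untouched (x ∷ xs) (Fin.suc k) v (here y≡x)  _   = here y≡x
∈-∷=⁺-untouched (x ∷ xs) (Fin.suc k) v (there y∈)  y≢  = there (∈-∷=⁺-untouched xs k v y∈ y≢)

crossing : ∀ {Q : ℕ → Set} → (∀ n → Dec (Q n)) → ∀ {a} b → a < b → Q a → ¬ Q b →
           ∃[ x ] (a ≤ x × x < b) × Q x × ¬ Q (suc x)
crossing Q? (suc b) a<sb qa ¬qsb with Q? b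
... | yes qb = b , (≤-pred a<sb , ≤-refl) , qb , ¬qsb
... | no ¬qb =
  let x , (a≤x , x<b) , qx , ¬qsx = crossing Q? b (≤∧≢⇒< (≤-pred a<sb) (λ { refl → ¬qb qa })) qa ¬qb
  in x , (a≤x , m<n⇒m<1+n x<b) , qx , ¬qsx

n≤m+m⇒⌈n/2⌉≤m : ∀ {n m} → n ≤ m + m → ⌈ n /2⌉ ≤ m
n≤m+m⇒⌈n/2⌉≤m {n} {m} n≤2m = ≤-trans (⌈n/2⌉-mono n≤2m) (≤-reflexive (sym (n≡⌈n+n/2⌉ m)))

n≤⌈n/2⌉+⌈n/2⌉ : ∀ n → n ≤ ⌈ n /2⌉ + ⌈ n /2⌉
n≤⌈n/2⌉+⌈n/2⌉ n = ≤-trans (≤-reflexive (sym (⌊n/2⌋+⌈n/2⌉≡n n))) (+-monoˡ-≤ ⌈ n /2⌉ (⌊n/2⌋≤⌈n/2⌉ n))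

⌈n/2⌉+⌈n/2⌉≤1+n : ∀ n → ⌈ n /2⌉ + ⌈ n /2⌉ ≤ suc n
⌈n/2⌉+⌈n/2⌉≤1+n n = ≤-trans (+-monoʳ-≤ ⌈ n /2⌉ (⌊n/2⌋≤⌈n/2⌉ (suc n))) (≤-reflexive (⌊n/2⌋+⌈n/2⌉≡n (suc n)))

module Forcing (G : Graph) where

  Completes-≐ : ∀ {S T : V G → Set} → S ≐′ T → Completes G S → Completes G T
  Completes-≐ (S⊆T , T⊆S) (done all) = done (λ x → S⊆T x (all x))
  Completes-≐ (S⊆T , T⊆S) (force u w su w∉S uw others c) =
    force u w (S⊆T u su) (w∉S ∘ T⊆S w) uw (λ x ux x≢w → S⊆T x (others x ux x≢w))
      (Completes-≐ ((λ x → Sum.map₁ (S⊆T x)) , (λ x → Sum.map₁ (T⊆S x))) c)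

  Forces : (V G → Set) → V G → V G → Set
  Forces S u w = S u × Adj G u w × (∀ x → Adj G u x → x ≢ w → S x)

  Forcer : (V G → Set) → V G → Set
  Forcer S w = ∃[ u ] Forces S u w

  Forces-⊆ : ∀ {S T u w} → S ⊆′ T → Forces S u w → Forces T u w
  Forces-⊆ S⊆T (su , uw , others) = S⊆T _ su , uw , (λ x ux x≢w → S⊆T x (others x ux x≢w))

  forceIfWhite : ∀ {S u w} → Decidable S → Forces S u w → Completes G (S ∪｛ w ｝) → Completes G S
  forceIfWhite {S} {u} {w} S? (su , uw , others) c with S? w
  ... | yes sw = Completes-≐ ((λ x → [ id , (λ { refl → sw }) ]) , (λ x → inj₁)) c
  ... | no w∉S = force u w su w∉S uw others c

  module _ (_≟_ : DecidableEquality (V G)) where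

    forceList : ∀ {S₀ S} → Decidable S → S₀ ⊆′ S → (ws : List (V G)) → (∀ w → w ∈ ws → Forcer S₀ w) →
                Completes G (λ x → S x ⊎ x ∈ ws) → Completes G S
    forceList S? _ [] _ c = Completes-≐ ((λ x → [ id , (λ ()) ]) , (λ x → inj₁)) c
    forceList {S₀} {S} S? S₀⊆S (w ∷ ws) forcers c =
      forceIfWhite S? (Forces-⊆ S₀⊆S (proj₂ (forcers w (here refl))))
        (forceList (S? ∪? (_≟ w)) (λ x s → inj₁ (S₀⊆S x s)) ws (λ x x∈ → forcers x (there x∈))
          (Completes-≐ ((λ x → [ inj₁ ∘ inj₁ , [ inj₁ ∘ inj₂ , inj₂ ] ∘ split ]) ,
                        (λ x → [ [ inj₁ , inj₂ ∘ here ] , inj₂ ∘ there ])) c))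
      where
      split : ∀ {x} → x ∈ w ∷ ws → x ≡ w ⊎ x ∈ ws
      split (here x≡w) = inj₁ x≡w
      split (there x∈) = inj₂ x∈

    forceAll : ∀ {S₀ S T} (vertices : List (V G)) → (∀ x → x ∈ vertices) → Decidable S → Decidable T →
               S₀ ⊆′ S → (∀ w → T w → Forcer S₀ w) → Completes G (λ x → S x ⊎ T x) → Completes G S
    forceAll vertices ∈-vertices S? T? S₀⊆S forcers c =
      forceList S? S₀⊆S (filter T? vertices) (λ w w∈ → forcers w (proj₂ (∈-filter⁻ T? {xs = vertices} w∈)))
        (Completes-≐ ((λ x → Sum.map₂ (∈-filter⁺ T? (∈-vertices x))) , (λ x → Sum.map₂ (proj₂ ∘ ∈-filter⁻ T? {xs = vertices}))) c)

module ChainEnds (G : Graph) where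

  Active : (V G → Set) → V G → Set
  Active S x = S x × ∃[ y ] (Adj G x y × ¬ S y)

  ActiveIn : (V G → Set) → List (V G) → Set
  ActiveIn S A = ∀ x → Active S x → x ∈ A

  record ChainStep (S : V G → Set) (A : List (V G)) (u w : V G) : Set where
    field
      position : Fin (length A)
      forcer   : u ≡ lookup A position
      active   : ActiveIn (S ∪｛ w ｝) (A [ position ]∷= w)

  chainStep : ∀ {S A u w} → S u → ¬ S w → Adj G u w → (∀ x → Adj G u x → x ≢ w → S x) →
              ActiveIn S A → ChainStep S A u w
  chainStep {S} {A} {u} {w} su w∉S uw others act = record
    { position = index u∈A ; forcer = lookup-index u∈A ; active = act′ }
    where
    u∈A : u ∈ A
    u∈A = act u (su , w , uw , w∉S)
    act′ : ActiveIn (S ∪｛ w ｝) (A [ index u∈A ]∷= w)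
    act′ x (inj₂ refl , _) = ∈-∷=⁺-updated A (index u∈A) x
    act′ x (inj₁ sx , y , xy , y∉S′) =
      ∈-∷=⁺-untouched A (index u∈A) w (act x (sx , y , xy , y∉S′ ∘ inj₁)) (x≢u ∘ (λ e → trans e (sym (lookup-index u∈A))))
      where
      x≢u : x ≢ u
      x≢u refl = y∉S′ (inj₁ (others y xy (y∉S′ ∘ inj₂)))

  module _ (_≟_ : DecidableEquality (V G)) (Φ : (V G → Set) → Set) (Φ? : ∀ {S} → Decidable S → Dec (Φ S))
           (¬Φ-all : ∀ {S} → (∀ x → S x) → ¬ Φ S) (K : ℕ)
           (critical : ∀ {S} → Decidable S → ∀ w → Φ S → ¬ Φ (S ∪｛ w ｝) → ∀ A A′ → length A′ ≡ length A →
                       ActiveIn S A → ActiveIn (S ∪｛ w ｝) A′ → K ≤ length A) where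

    boundAtCriticalForce : ∀ {S} → Completes G S → Decidable S → Φ S → ∀ A → ActiveIn S A → K ≤ length A
    boundAtCriticalForce (done all) _ φ _ _ = ⊥-elim (¬Φ-all all φ)
    boundAtCriticalForce (force u w su w∉S uw others c) S? φ A act with Φ? (S? ∪? (_≟ w))
    ... | yes φ′ = subst (K ≤_) (length-∷= A position w) (boundAtCriticalForce c (S? ∪? (_≟ w)) φ′ _ active)
      where open ChainStep (chainStep su w∉S uw others act)
    ... | no ¬φ′ = critical S? w φ ¬φ′ A _ (length-∷= A position w) act active
      where open ChainStep (chainStep su w∉S uw others act)

  module _ {I : Set} (leaf stem : I → V G) (leaf-adj : ∀ i y → Adj G (leaf i) y → y ≡ stem i)
           (adj-leaf : ∀ i y → Adj G y (leaf i) → y ≡ stem i) where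

    -- A leaf outside S₀ is forced by its stem, so it can never force and remains a chain end.
    forcedLeavesAreChainEnds : ∀ {S₀ S : V G → Set} → Completes G S → ∀ A → ActiveIn S A →
      (∀ i → S (leaf i) → ¬ S₀ (leaf i) → leaf i ∈ A × S (stem i)) →
      ∃[ A′ ] length A′ ≡ length A × (∀ i → ¬ S₀ (leaf i) → leaf i ∈ A′)
    forcedLeavesAreChainEnds (done all) A _ inv = A , refl , λ i ¬s₀ → proj₁ (inv i (all _) ¬s₀)
    forcedLeavesAreChainEnds {S₀} {S} (force u w su w∉S uw others c) A act inv =
      let A′ , len , ends = forcedLeavesAreChainEnds {S₀} c (A [ position ]∷= w) active inv′
      in A′ , trans len (length-∷= A position w) , ends
      where
      open ChainStep (chainStep su w∉S uw others act)
      inv′ : ∀ i → (S ∪｛ w ｝) (leaf i) → ¬ S₀ (leaf i) → leaf i ∈ A [ position ]∷= w × (S ∪｛ w ｝) (stem i)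
      inv′ i (inj₂ leaf≡w) _ =
        subst (_∈ A [ position ]∷= w) (sym leaf≡w) (∈-∷=⁺-updated A position w) ,
        inj₁ (subst S (adj-leaf i u (subst (Adj G u) (sym leaf≡w) uw)) su)
      inv′ i (inj₁ s) ¬s₀ = ∈-∷=⁺-untouched A position w leaf∈A leaf≢u , inj₁ stem∈S
        where
        leaf∈A : leaf i ∈ A
        leaf∈A = proj₁ (inv i s ¬s₀)
        stem∈S : S (stem i)
        stem∈S = proj₂ (inv i s ¬s₀)
        leaf≢u : leaf i ≢ lookup A position
        leaf≢u e = w∉S (subst S (sym (leaf-adj i w (subst (λ z → Adj G z w) (trans forcer (sym e)) uw))) stem∈S)

  module Path {N : ℕ} (φ : Fin N → V G) (adj : ∀ i j → PathAdj N i j → Adj G (φ i) (φ j))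
              {S : V G → Set} (S? : Decidable S) where

    -- Positions are natural numbers; Blue n is false for n ≥ N, hence the bounds b < N below.
    Blue : ℕ → Set
    Blue n = Σ (n < N) λ n<N → S (φ (fromℕ< n<N))

    blue? : ∀ n → Dec (Blue n)
    blue? n with n <? N
    ... | no n≮N = no (n≮N ∘ proj₁)
    ... | yes n<N with S? (φ (fromℕ< n<N))
    ...   | yes s = yes (n<N , s)
    ...   | no ¬s = no (¬s ∘ proj₂)

    ActiveAt : ℕ → Set
    ActiveAt n = Σ (n < N) λ n<N → Active S (φ (fromℕ< n<N))

    blue⁺ : ∀ i → S (φ i) → Blue (toℕ i)
    blue⁺ i s = toℕ<n i , subst (S ∘ φ) (sym (fromℕ<-toℕ i (toℕ<n i))) s

    white⁺ : ∀ i → ¬ S (φ i) → ¬ Blue (toℕ i)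
    white⁺ i ¬s (i<N , s) = ¬s (subst (S ∘ φ) (fromℕ<-toℕ i i<N) s)

    successor : ∀ x .(x<N : x < N) .(sx<N : suc x < N) → suc (toℕ (fromℕ< x<N)) ≡ toℕ (fromℕ< sx<N)
    successor x x<N sx<N = trans (cong suc (toℕ-fromℕ< x<N)) (sym (toℕ-fromℕ< sx<N))

    activeUp : ∀ {a b} → a < b → b < N → Blue a → ¬ Blue b → ∃[ x ] (a ≤ x × x < b) × ActiveAt x
    activeUp {b = b} a<b b<N qa ¬qb with crossing blue? b a<b qa ¬qb
    ... | x , (a≤x , x<b) , (x<N , sx) , ¬qsx =
      x , (a≤x , x<b) , x<N , sx , φ (fromℕ< sx<N) , adj _ _ (inj₁ (successor x x<N sx<N)) , (λ s → ¬qsx (sx<N , s))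
      where
      sx<N : suc x < N
      sx<N = ≤-<-trans x<b b<N

    activeDown : ∀ {a b} → a < b → b < N → ¬ Blue a → Blue b → ∃[ x ] (a < x × x ≤ b) × ActiveAt x
    activeDown {b = b} a<b b<N ¬qa qb with crossing (¬? ∘ blue?) b a<b ¬qa (λ ¬qb → ¬qb qb)
    ... | x , (a≤x , x<b) , ¬qx , ¬¬qsx =
      suc x , (s≤s a≤x , x<b) , sx<N , proj₂ qsx , φ (fromℕ< x<N) , adj _ _ (inj₂ (successor x x<N sx<N)) , (λ s → ¬qx (x<N , s))
      where
      sx<N : suc x < N
      sx<N = ≤-<-trans x<b b<N
      x<N : x < N
      x<N = <-trans (n<1+n x) sx<N
      qsx : Blue (suc x)
      qsx = decidable-stable (blue? (suc x)) ¬¬qsx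

    activeAt⇒active : ∀ {x} → ActiveAt x → ∃[ i ] Active S (φ i)
    activeAt⇒active (x<N , act) = fromℕ< x<N , act

    active : ∀ a b → S (φ a) → ¬ S (φ b) → ∃[ i ] Active S (φ i)
    active a b sa ¬sb with <-cmp (toℕ a) (toℕ b)
    ... | tri< a<b _ _ = activeAt⇒active (proj₂ (proj₂ (activeUp a<b (toℕ<n b) (blue⁺ a sa) (white⁺ b ¬sb))))
    ... | tri≈ _ a≡b _ = ⊥-elim (¬sb (subst (S ∘ φ) (toℕ-injective a≡b) sa))
    ... | tri> _ _ b<a = activeAt⇒active (proj₂ (proj₂ (activeDown b<a (toℕ<n a) (white⁺ b ¬sb) (blue⁺ a sa))))

  module Cycle {N₁ : ℕ} (φ : Fin (suc N₁) → V G) (adj : ∀ i j → CycAdj (suc N₁) i j → Adj G (φ i) (φ j))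
               {S : V G → Set} (S? : Decidable S) where

    open Path φ (λ i j → adj i j ∘ Sum.map₂ inj₁) S?

    TwoActive : Set
    TwoActive = ∃[ x ] ∃[ y ] x ≢ y × ActiveAt x × ActiveAt y

    0<N : 0 < suc N₁
    0<N = z<s

    activeLast : Blue N₁ → ¬ Blue 0 → ActiveAt N₁
    activeLast (N₁<N , s) ¬q0 =
      N₁<N , s , φ (fromℕ< 0<N) , adj _ _ (inj₂ (inj₂ (inj₂ (toℕ-fromℕ< 0<N , cong suc (toℕ-fromℕ< N₁<N))))) ,
      (λ s0 → ¬q0 (0<N , s0))

    activeFirst : Blue 0 → ¬ Blue N₁ → ActiveAt 0
    activeFirst (0<N , s) ¬qN₁ =
      0<N , s , φ (fromℕ< ≤-refl) , adj _ _ (inj₂ (inj₂ (inj₁ (toℕ-fromℕ< 0<N , cong suc (toℕ-fromℕ< ≤-refl))))) ,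
      (λ sN₁ → ¬qN₁ (≤-refl , sN₁))

    -- From each of the two blue vertices walk towards w (on either side of the cycle, through the
    -- edge N₁ — 0 if necessary); the first blue vertex next to a white one is active on each walk.
    twoActive-white-first : ∀ {b₁ b₂ w} → w < b₁ → b₁ < b₂ → b₂ < suc N₁ → Blue b₁ → Blue b₂ → ¬ Blue w → TwoActive
    twoActive-white-first {b₁} {b₂} {w} w<b₁ b₁<b₂ b₂<N q₁ q₂ ¬qw
      with activeDown w<b₁ (<-trans b₁<b₂ b₂<N) ¬qw q₁
    ... | y , (w<y , y≤b₁) , act-y with blue? N₁
    ...   | no ¬qN₁ =
      let x , (b₂≤x , _) , act-x = activeUp b₂<N₁ ≤-refl q₂ ¬qN₁
      in y , x , (λ y≡x → <-irrefl y≡x (≤-<-trans y≤b₁ (<-≤-trans b₁<b₂ b₂≤x))) , act-y , act-x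
      where
      b₂<N₁ : b₂ < N₁
      b₂<N₁ = ≤∧≢⇒< (≤-pred b₂<N) (λ b₂≡N₁ → ¬qN₁ (subst Blue b₂≡N₁ q₂))
    ...   | yes qN₁ with blue? 0
    ...     | no ¬q0 = y , N₁ , (λ y≡N₁ → <-irrefl y≡N₁ (≤-<-trans y≤b₁ (<-≤-trans b₁<b₂ (≤-pred b₂<N)))) , act-y , activeLast qN₁ ¬q0
    ...     | yes q0 =
      let x , (_ , x<w) , act-x = activeUp (≤∧≢⇒< z≤n (λ 0≡w → ¬qw (subst Blue 0≡w q0))) (<-trans w<b₁ (<-trans b₁<b₂ b₂<N)) q0 ¬qw
      in y , x , (λ y≡x → <-irrefl (sym y≡x) (<-trans x<w w<y)) , act-y , act-x

    twoActive-white-between : ∀ {b₁ b₂ w} → b₁ < w → w < b₂ → b₂ < suc N₁ → Blue b₁ → Blue b₂ → ¬ Blue w → TwoActive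
    twoActive-white-between b₁<w w<b₂ b₂<N q₁ q₂ ¬qw =
      let x , (_ , x<w) , act-x = activeUp b₁<w (<-trans w<b₂ b₂<N) q₁ ¬qw
          y , (w<y , _) , act-y = activeDown w<b₂ b₂<N ¬qw q₂
      in x , y , (λ x≡y → <-irrefl x≡y (<-trans x<w w<y)) , act-x , act-y

    twoActive-white-last : ∀ {b₁ b₂ w} → b₁ < b₂ → b₂ < w → w < suc N₁ → Blue b₁ → Blue b₂ → ¬ Blue w → TwoActive
    twoActive-white-last {b₁} {b₂} {w} b₁<b₂ b₂<w w<N q₁ q₂ ¬qw with activeUp b₂<w w<N q₂ ¬qw
    ... | x , (b₂≤x , x<w) , act-x with blue? 0
    ...   | no ¬q0 =
      let y , (_ , y≤b₁) , act-y = activeDown (≤∧≢⇒< z≤n (λ 0≡b₁ → ¬q0 (subst Blue (sym 0≡b₁) q₁))) (<-trans b₁<b₂ (<-trans b₂<w w<N)) ¬q0 q₁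
      in x , y , (λ x≡y → <-irrefl (sym x≡y) (≤-<-trans y≤b₁ (<-≤-trans b₁<b₂ b₂≤x))) , act-x , act-y
    ...   | yes q0 with blue? N₁
    ...     | no ¬qN₁ = x , 0 , (λ x≡0 → <-irrefl (sym x≡0) (≤-<-trans z≤n (<-≤-trans b₁<b₂ b₂≤x))) , act-x , activeFirst q0 ¬qN₁
    ...     | yes qN₁ =
      let y , (w<y , _) , act-y = activeDown (≤∧≢⇒< (≤-pred w<N) (λ w≡N₁ → ¬qw (subst Blue (sym w≡N₁) qN₁))) ≤-refl ¬qw qN₁
      in x , y , (λ x≡y → <-irrefl x≡y (<-trans x<w w<y)) , act-x , act-y

    twoActiveℕ : ∀ {b₁ b₂ w} → b₁ < b₂ → b₂ < suc N₁ → w < suc N₁ → Blue b₁ → Blue b₂ → ¬ Blue w → TwoActive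
    twoActiveℕ {b₁} {b₂} {w} b₁<b₂ b₂<N w<N q₁ q₂ ¬qw with <-cmp w b₁ | <-cmp w b₂
    ... | tri< w<b₁ _ _ | _              = twoActive-white-first w<b₁ b₁<b₂ b₂<N q₁ q₂ ¬qw
    ... | tri≈ _ w≡b₁ _ | _              = ⊥-elim (¬qw (subst Blue (sym w≡b₁) q₁))
    ... | tri> _ _ b₁<w | tri< w<b₂ _ _ = twoActive-white-between b₁<w w<b₂ b₂<N q₁ q₂ ¬qw
    ... | tri> _ _ _    | tri≈ _ w≡b₂ _ = ⊥-elim (¬qw (subst Blue (sym w≡b₂) q₂))
    ... | tri> _ _ _    | tri> _ _ b₂<w = twoActive-white-last b₁<b₂ b₂<w w<N q₁ q₂ ¬qw

    toFin : TwoActive → ∃[ x ] ∃[ y ] x ≢ y × Active S (φ x) × Active S (φ y)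
    toFin (x , y , x≢y , (x<N , act-x) , (y<N , act-y)) =
      fromℕ< x<N , fromℕ< y<N , (λ e → x≢y (trans (sym (toℕ-fromℕ< x<N)) (trans (cong toℕ e) (toℕ-fromℕ< y<N)))) , act-x , act-y

    twoActive : ∀ b₁ b₂ w → b₁ ≢ b₂ → S (φ b₁) → S (φ b₂) → ¬ S (φ w) →
                ∃[ x ] ∃[ y ] x ≢ y × Active S (φ x) × Active S (φ y)
    twoActive b₁ b₂ w b₁≢b₂ s₁ s₂ ¬sw with <-cmp (toℕ b₁) (toℕ b₂)
    ... | tri< b₁<b₂ _ _ = toFin (twoActiveℕ b₁<b₂ (toℕ<n b₂) (toℕ<n w) (blue⁺ b₁ s₁) (blue⁺ b₂ s₂) (white⁺ w ¬sw))
    ... | tri≈ _ b₁≡b₂ _ = ⊥-elim (b₁≢b₂ (toℕ-injective b₁≡b₂))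
    ... | tri> _ _ b₂<b₁ = toFin (twoActiveℕ b₂<b₁ (toℕ<n b₁) (toℕ<n w) (blue⁺ b₂ s₂) (blue⁺ b₁ s₁) (white⁺ w ¬sw))

module WebGraph (m r : ℕ) where

  Vertex : Set
  Vertex = WbV m r

  G : Graph
  G = Web m r

  v : Fin m → Fin r → Vertex
  v i j = inj₁ (i , j)

  p : Fin m → Vertex
  p i = inj₂ i

  column : Vertex → Fin m
  column (inj₁ (i , _)) = i
  column (inj₂ i) = i

  col : Vertex → ℕ
  col x = toℕ (column x)

  level : Vertex → ℕ
  level (inj₁ (_ , j)) = suc (toℕ j)
  level (inj₂ _) = 0

  level≤r : ∀ x → level x ≤ r
  level≤r (inj₁ (_ , j)) = toℕ<n j
  level≤r (inj₂ _) = z≤n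

  _≟ᵥ_ : DecidableEquality Vertex
  _≟ᵥ_ = ≡-dec⊎ (≡-dec× _≟ᶠ_ _≟ᶠ_) _≟ᶠ_

  vertices : List Vertex
  vertices = map inj₁ (cartesianProduct (allFin m) (allFin r)) ++ map inj₂ (allFin m)

  ∈-vertices : ∀ x → x ∈ vertices
  ∈-vertices (inj₁ (i , j)) = ∈-++⁺ˡ (∈-map⁺ inj₁ (∈-cartesianProduct⁺ (∈-allFin i) (∈-allFin j)))
  ∈-vertices (inj₂ i) = ∈-++⁺ʳ _ (∈-map⁺ inj₂ (∈-allFin i))

  v-injective : ∀ {i i′ j j′} → v i j ≡ v i′ j′ → i ≡ i′ × j ≡ j′
  v-injective refl = refl , refl

  position-injective : ∀ x y → column x ≡ column y → level x ≡ level y → x ≡ y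
  position-injective (inj₁ (i , j)) (inj₁ (_ , j′)) refl e = cong (v i) (toℕ-injective (suc-injective e))
  position-injective (inj₂ i) (inj₂ _) refl _ = refl
  position-injective (inj₁ _) (inj₂ _) _ ()
  position-injective (inj₂ _) (inj₁ _) _ ()

  pendant-neighbour-unique : ∀ i {x y} → WbAdj m r (p i) x → WbAdj m r (p i) y → x ≡ y
  pendant-neighbour-unique i {inj₁ _} {inj₁ _} (refl , j≡0) (refl , j′≡0) = cong (v i) (toℕ-injective (trans j≡0 (sym j′≡0)))
  pendant-neighbour-unique i {inj₂ _} ()
  pendant-neighbour-unique i {inj₁ _} {inj₂ _} _ ()

  data Neighbour (x y : Vertex) : Set where
    sideways : level y ≡ level x → CycAdj m (column x) (column y) → Neighbour x y
    above    : column y ≡ column x → level y ≡ suc (level x) → Neighbour x y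
    below    : column y ≡ column x → suc (level y) ≡ level x → Neighbour x y

  neighbour : ∀ x y → WbAdj m r x y → Neighbour x y
  neighbour (inj₂ _) (inj₂ _) ()
  neighbour (inj₂ _) (inj₁ _) (refl , e) = above refl (cong suc e)
  neighbour (inj₁ _) (inj₂ _) (refl , e) = below refl (cong suc (sym e))
  neighbour (inj₁ _) (inj₁ _) (inj₁ (refl , inj₁ e)) = above refl (cong suc (sym e))
  neighbour (inj₁ _) (inj₁ _) (inj₁ (refl , inj₂ e)) = below refl (cong suc e)
  neighbour (inj₁ _) (inj₁ _) (inj₂ (refl , c)) = sideways refl c

  cycAdj-interior : ∀ c c′ → CycAdj m c c′ → 1 ≤ toℕ c → suc (suc (toℕ c)) ≤ m →
                    toℕ c′ ≡ suc (toℕ c) ⊎ suc (toℕ c′) ≡ toℕ c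
  cycAdj-interior c c′ (inj₁ e) _ _ = inj₁ (sym e)
  cycAdj-interior c c′ (inj₂ (inj₁ e)) _ _ = inj₂ e
  cycAdj-interior c c′ (inj₂ (inj₂ (inj₁ (c≡0 , _)))) 1≤c _ = ⊥-elim (<-irrefl (sym c≡0) 1≤c)
  cycAdj-interior c c′ (inj₂ (inj₂ (inj₂ (_ , sc≡m)))) _ ssc≤m = ⊥-elim (<-irrefl sc≡m ssc≤m)

module LowerBound (k r′ : ℕ) where

  m : ℕ
  m = suc (suc (suc k))

  r : ℕ
  r = suc r′

  open WebGraph m r
  open ChainEnds G
  open import Data.List.Membership.DecPropositional _≟ᵥ_ using (_∈?_)

  pendant-adj : ∀ i y → WbAdj m r (p i) y → y ≡ v i Fin.zero
  pendant-adj i y a = pendant-neighbour-unique i a (refl , refl)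

  adj-pendant : ∀ i y → WbAdj m r y (p i) → y ≡ v i Fin.zero
  adj-pendant i (inj₁ _) (i′≡i , j≡0) = pendant-adj i _ (sym i′≡i , j≡0)
  adj-pendant i (inj₂ _) ()

  pendantBound : ∀ B → Completes G (_∈ B) → m ≤ length B + length B
  pendantBound B zfs with forcedLeavesAreChainEnds p (λ i → v i Fin.zero) pendant-adj adj-pendant {S₀ = _∈ B}
                            zfs B (λ _ → proj₁) (λ _ p∈B p∉B → ⊥-elim (p∉B p∈B))
  ... | A′ , length-A′ , ends = begin
    m                       ≤⟨ fin-injection⇒≤length p inj₂-injective (B ++ A′) p∈B++A′ ⟩
    length (B ++ A′)        ≡⟨ length-++ B ⟩
    length B + length A′    ≡⟨ cong (length B +_) length-A′ ⟩
    length B + length B     ∎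
    where
    open ≤-Reasoning
    p∈B++A′ : ∀ i → p i ∈ B ++ A′
    p∈B++A′ i with p i ∈? B
    ... | yes p∈B = ∈-++⁺ˡ p∈B
    ... | no p∉B = ∈-++⁺ʳ B (ends i p∉B)

  m≤length : ∀ A → (∀ i → ∃[ j ] v i j ∈ A) → m ≤ length A
  m≤length A hit = fin-injection⇒≤length (λ i → v i (proj₁ (hit i))) (proj₁ ∘ v-injective) A (proj₂ ∘ hit)

  2r≤length : ∀ A → (∀ j → ∃[ i₁ ] ∃[ i₂ ] i₁ ≢ i₂ × v i₁ j ∈ A × v i₂ j ∈ A) → r + r ≤ length A
  2r≤length A hit = fin-injection⇒≤length (f ∘ splitAt r) (λ e → splitAt-injective (f-injective e)) A f∈A
    where
    f : Fin r ⊎ Fin r → Vertex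
    f (inj₁ j) = v (proj₁ (hit j)) j
    f (inj₂ j) = v (proj₁ (proj₂ (hit j))) j
    f-injective : ∀ {a b} → f a ≡ f b → a ≡ b
    f-injective {inj₁ _} {inj₁ _} e = cong inj₁ (proj₂ (v-injective e))
    f-injective {inj₂ _} {inj₂ _} e = cong inj₂ (proj₂ (v-injective e))
    f-injective {inj₁ a} {inj₂ _} e with v-injective e
    ... | i₁≡i₂ , refl = ⊥-elim (proj₁ (proj₂ (proj₂ (hit a))) i₁≡i₂)
    f-injective {inj₂ a} {inj₁ _} e with v-injective e
    ... | i₂≡i₁ , refl = ⊥-elim (proj₁ (proj₂ (proj₂ (hit a))) (sym i₂≡i₁))
    splitAt-injective : ∀ {s t} → splitAt r s ≡ splitAt r t → s ≡ t
    splitAt-injective {s} {t} e = trans (sym (join-splitAt r r s)) (trans (cong (join r r) e) (join-splitAt r r t))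
    f∈A : ∀ t → f (splitAt r t) ∈ A
    f∈A t with splitAt r t
    ... | inj₁ j = proj₁ (proj₂ (proj₂ (proj₂ (hit j))))
    ... | inj₂ j = proj₂ (proj₂ (proj₂ (proj₂ (hit j))))

  columnAdj : ∀ i j j′ → PathAdj r j j′ → WbAdj m r (v i j) (v i j′)
  columnAdj i j j′ a = inj₁ (refl , a)

  rowAdj : ∀ j i i′ → CycAdj m i i′ → WbAdj m r (v i j) (v i′ j)
  rowAdj j i i′ a = inj₂ (refl , a)

  activeInColumn : ∀ {S} → Decidable S → ∀ i {j₁ j₂} → S (v i j₁) → ¬ S (v i j₂) → ∃[ j ] Active S (v i j)
  activeInColumn S? i = Path.active (v i) (columnAdj i) S? _ _

  twoActiveInRow : ∀ {S} → Decidable S → ∀ j {i₁ i₂ i} → i₁ ≢ i₂ → S (v i₁ j) → S (v i₂ j) → ¬ S (v i j) →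
                   ∃[ x ] ∃[ y ] x ≢ y × Active S (v x j) × Active S (v y j)
  twoActiveInRow S? j = Cycle.twoActive (λ i → v i j) (rowAdj j) S? _ _ _

  distinct : ∀ {a b x y : ℕ} → a ≡ x → b ≡ y → x ≢ y → a ≢ b
  distinct a≡x b≡y x≢y a≡b = x≢y (trans (sym a≡x) (trans a≡b b≡y))

  twoNeighbours : ∀ c → ∃[ a ] ∃[ b ] (CycAdj m c a × CycAdj m c b) × toℕ a ≢ toℕ b × toℕ a ≢ toℕ c × toℕ b ≢ toℕ c
  twoNeighbours c with toℕ c in c≡
  ... | zero =
    fromℕ< 1<m , fromℕ< last<m , (inj₁ (sym 1≡) , inj₂ (inj₂ (inj₁ (refl , cong suc last≡)))) ,
    distinct 1≡ last≡ (λ ()) , distinct 1≡ refl (λ ()) , distinct last≡ refl (λ ())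
    where
    1<m : 1 < m
    1<m = s≤s (s≤s z≤n)
    1≡ : toℕ (fromℕ< 1<m) ≡ 1
    1≡ = toℕ-fromℕ< 1<m
    last<m : suc (suc k) < m
    last<m = ≤-refl
    last≡ : toℕ (fromℕ< last<m) ≡ suc (suc k)
    last≡ = toℕ-fromℕ< last<m
  ... | suc n with suc (suc n) <? m
  ...   | yes n+2<m =
    fromℕ< n+2<m , fromℕ< n<m , (inj₁ (sym n+2≡) , inj₂ (inj₁ (cong suc n≡))) ,
    distinct n+2≡ n≡ (λ e → <-irrefl (sym e) (<-trans (n<1+n n) (n<1+n (suc n)))) ,
    distinct n+2≡ refl 1+n≢n , distinct n≡ refl (1+n≢n ∘ sym)
    where
    n<m : n < m
    n<m = <-trans (<-trans (n<1+n n) (n<1+n (suc n))) n+2<m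
    n≡ : toℕ (fromℕ< n<m) ≡ n
    n≡ = toℕ-fromℕ< n<m
    n+2≡ : toℕ (fromℕ< n+2<m) ≡ suc (suc n)
    n+2≡ = toℕ-fromℕ< n+2<m
  ...   | no n+2≮m =
    fromℕ< 0<m , fromℕ< n<m , (inj₂ (inj₂ (inj₂ (0≡ , n+2≡m))) , inj₂ (inj₁ (cong suc n≡))) ,
    distinct 0≡ n≡ (λ 0≡n → 0≢1+n (trans 0≡n (suc-injective (suc-injective n+2≡m)))) ,
    distinct 0≡ refl (λ ()) , distinct n≡ refl (1+n≢n ∘ sym)
    where
    n+2≡m : suc (suc n) ≡ m
    n+2≡m = ≤-antisym (subst (_< m) c≡ (toℕ<n c)) (≮⇒≥ n+2≮m)
    n<m : n < m
    n<m = subst (n <_) n+2≡m (<-trans (n<1+n n) (n<1+n (suc n)))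
    n≡ : toℕ (fromℕ< n<m) ≡ n
    n≡ = toℕ-fromℕ< n<m
    0<m : 0 < m
    0<m = z<s
    0≡ : toℕ (fromℕ< 0<m) ≡ 0
    0≡ = toℕ-fromℕ< 0<m

  neighbourAvoiding : ∀ c g → ∃[ i ] CycAdj m c i × i ≢ g × i ≢ c
  neighbourAvoiding c g with twoNeighbours c
  ... | a , b , (c~a , c~b) , a≢b , a≢c , b≢c with a ≟ᶠ g
  ...   | no a≢g = a , c~a , a≢g , a≢c ∘ cong toℕ
  ...   | yes refl = b , c~b , (λ b≡a → a≢b (cong toℕ (sym b≡a))) , b≢c ∘ cong toℕ

  EveryColumnActive : (Vertex → Set) → Set
  EveryColumnActive S = ∀ i → ∃[ j ] Active S (v i j)

  EveryRowTwiceActive : (Vertex → Set) → Set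
  EveryRowTwiceActive S = ∀ j → ∃[ i₁ ] ∃[ i₂ ] i₁ ≢ i₂ × Active S (v i₁ j) × Active S (v i₂ j)

  -- S is the colouring just before column c, the last column without blue vertices, receives v c j₀.
  module FirstVertexInColumn {S : Vertex → Set} (S? : Decidable S) (c : Fin m) (j₀ : Fin r)
                             (c-white : ∀ j → ¬ S (v c j)) (c-only : ∀ i → i ≢ c → ∃[ j ] S (v i j)) where

    S′ : Vertex → Set
    S′ = S ∪｛ v c j₀ ｝

    S′? : Decidable S′
    S′? = S? ∪? (_≟ᵥ v c j₀)

    white′ : ∀ {i j} → i ≢ c → ¬ S (v i j) → ¬ S′ (v i j)
    white′ _ ¬s (inj₁ s) = ¬s s
    white′ i≢c _ (inj₂ e) = i≢c (proj₁ (v-injective e))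

    white′-c : ∀ {j} → j ≢ j₀ → ¬ S′ (v c j)
    white′-c _ (inj₁ s) = c-white _ s
    white′-c j≢j₀ (inj₂ e) = j≢j₀ (proj₂ (v-injective e))

    activeOffColumn : ∀ i {j} → i ≢ c → ¬ S (v i j) → ∃[ j ] Active S′ (v i j)
    activeOffColumn i i≢c ¬s = activeInColumn S′? i (inj₁ (proj₂ (c-only i i≢c))) (white′ i≢c ¬s)

    anotherRow : ∀ {i j j′} → S (v i j) → ¬ S (v i j′) → ∃[ j″ ] j″ ≢ j₀
    anotherRow {j = j} {j′} s ¬s with j ≟ᶠ j₀
    ... | no j≢j₀ = j , j≢j₀
    ... | yes refl = j′ , (λ { refl → ¬s s })

    whiteInEveryColumn : (∀ g → ¬ (∀ j → S (v g j))) → ∀ i → ∃[ j ] ¬ S (v i j)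
    whiteInEveryColumn ¬full i = ¬∀⟶∃¬ r _ (λ j → S? (v i j)) (¬full i)

    noFullColumn : (∀ g → ¬ (∀ j → S (v g j))) → EveryColumnActive S′
    noFullColumn ¬full i with i ≟ᶠ c
    ... | no i≢c = activeOffColumn i i≢c (proj₂ (whiteInEveryColumn ¬full i))
    ... | yes refl = activeInColumn S′? c (inj₂ refl) (white′-c (proj₂ j≢j₀))
      where
      i′ : Fin m
      i′ = proj₁ (neighbourAvoiding c c)
      j≢j₀ : ∃[ j ] j ≢ j₀
      j≢j₀ = anotherRow (proj₂ (c-only i′ (proj₂ (proj₂ (proj₂ (neighbourAvoiding c c))))))
                        (proj₂ (whiteInEveryColumn ¬full i′))

    fullColumnNoThinRow : ∀ g → (∀ j → S (v g j)) → (∀ j → ∃[ i ] i ≢ g × S (v i j)) → EveryRowTwiceActive S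
    fullColumnNoThinRow g full blueOff j =
      twoActiveInRow S? j (λ g≡i → proj₁ (proj₂ (blueOff j)) (sym g≡i)) (full j) (proj₂ (proj₂ (blueOff j))) (c-white j)

    thinRow : ∀ g j₁ → (∀ j → S (v g j)) → (∀ i → i ≡ g ⊎ ¬ S (v i j₁)) → EveryColumnActive S′
    thinRow g j₁ full thin i with i ≟ᶠ c
    ... | yes refl with j₁ ≟ᶠ j₀
    ...   | no j₁≢j₀ = activeInColumn S′? c (inj₂ refl) (white′-c j₁≢j₀)
    ...   | yes refl =
      let i′ , c~i′ , i′≢g , i′≢c = neighbourAvoiding c g
      in j₀ , inj₂ refl , v i′ j₀ , rowAdj j₀ c i′ c~i′ , whiteThin i′≢g i′≢c
      where
      whiteThin : ∀ {i} → i ≢ g → i ≢ c → ¬ S′ (v i j₁)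
      whiteThin i≢g i≢c = white′ i≢c ([ ⊥-elim ∘ i≢g , id ]′ (thin _))
    thinRow g j₁ full thin i | no i≢c with i ≟ᶠ g
    ...   | yes refl =
      let i′ , g~i′ , i′≢c , i′≢g = neighbourAvoiding g c
      in j₁ , inj₁ (full j₁) , v i′ j₁ , rowAdj j₁ g i′ g~i′ , white′ i′≢c ([ ⊥-elim ∘ i′≢g , id ]′ (thin i′))
    ...   | no i≢g = activeOffColumn i {j₁} i≢c ([ ⊥-elim ∘ i≢g , id ]′ (thin i))

    firstVertexInColumn : EveryColumnActive S′ ⊎ EveryRowTwiceActive S
    firstVertexInColumn with any? (λ g → all? (λ j → S? (v g j)))
    ... | no ¬full = inj₁ (noFullColumn (λ g full → ¬full (g , full)))
    ... | yes (g , full) with any? (λ j → all? (λ i → (i ≟ᶠ g) ⊎-dec ¬? (S? (v i j))))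
    ...   | yes (j₁ , thin) = inj₁ (thinRow g j₁ full thin)
    ...   | no ¬thin = inj₂ (fullColumnNoThinRow g full blueOff)
      where
      blueOff : ∀ j → ∃[ i ] i ≢ g × S (v i j)
      blueOff j =
        let i , ¬thin-i = ¬∀⟶∃¬ m _ (λ i → (i ≟ᶠ g) ⊎-dec ¬? (S? (v i j))) (λ thin → ¬thin (j , thin))
        in i , ¬thin-i ∘ inj₁ , decidable-stable (S? (v i j)) (¬thin-i ∘ inj₂)

  MissesColumn : (Vertex → Set) → Set
  MissesColumn S = ∃[ c ] ∀ j → ¬ S (v c j)

  missesColumn? : ∀ {S} → Decidable S → Dec (MissesColumn S)
  missesColumn? S? = any? (λ c → all? (λ j → ¬? (S? (v c j))))

  meetsEveryColumn : ∀ {S} → Decidable S → ¬ MissesColumn S → ∀ i → ∃[ j ] S (v i j)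
  meetsEveryColumn S? ¬miss i =
    let j , ¬¬s = ¬∀⟶∃¬ r _ (λ j → ¬? (S? (v i j))) (λ white → ¬miss (i , white))
    in j , decidable-stable (S? (v i j)) ¬¬s

  m⊓2r : ℕ
  m⊓2r = m ⊓ (2 * r)

  m≤⇒m⊓2r≤ : ∀ {n} → m ≤ n → m⊓2r ≤ n
  m≤⇒m⊓2r≤ = ≤-trans (m⊓n≤m m (2 * r))

  2r≤⇒m⊓2r≤ : ∀ {n} → r + r ≤ n → m⊓2r ≤ n
  2r≤⇒m⊓2r≤ 2r≤n = ≤-trans (m⊓n≤n m (2 * r)) (≤-trans (≤-reflexive (cong (r +_) (+-identityʳ r))) 2r≤n)

  criticalForce : ∀ {S} → Decidable S → ∀ w → MissesColumn S → ¬ MissesColumn (S ∪｛ w ｝) →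
                  ∀ A A′ → length A′ ≡ length A → ActiveIn S A → ActiveIn (S ∪｛ w ｝) A′ → m⊓2r ≤ length A
  criticalForce {S} S? w (c , c-white) ¬miss′ A A′ len act act′ with meetsEveryColumn (S? ∪? (_≟ᵥ w)) ¬miss′ c
  ... | j₀ , inj₁ s = ⊥-elim (c-white j₀ s)
  ... | j₀ , inj₂ refl with FirstVertexInColumn.firstVertexInColumn S? c j₀ c-white c-only
    where
    c-only : ∀ i → i ≢ c → ∃[ j ] S (v i j)
    c-only i i≢c with meetsEveryColumn (S? ∪? (_≟ᵥ w)) ¬miss′ i
    ... | j , inj₁ s = j , s
    ... | j , inj₂ e = ⊥-elim (i≢c (proj₁ (v-injective e)))
  ...   | inj₁ columns = m≤⇒m⊓2r≤ (subst (m ≤_) len (m≤length A′ (λ i → Product.map₂ (act′ _) (columns i))))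
  ...   | inj₂ rows = 2r≤⇒m⊓2r≤ (2r≤length A (λ j → Product.map₂ (Product.map₂ (Product.map₂ (Product.map (act _) (act _)))) (rows j)))

  lowerBound : ∀ B → IsZFS G B → ⌈ m /2⌉ ⊔ m⊓2r ≤ length B
  lowerBound B zfs = ⊔-lub (n≤m+m⇒⌈n/2⌉≤m (pendantBound B zfs)) columnBound
    where
    columnBound : m⊓2r ≤ length B
    columnBound with missesColumn? (_∈? B)
    ... | yes miss = boundAtCriticalForce _≟ᵥ_ MissesColumn missesColumn? (λ all (c , white) → white Fin.zero (all _))
                       m⊓2r criticalForce zfs (_∈? B) miss B (λ _ → proj₁)
    ... | no ¬miss = m≤⇒m⊓2r≤ (m≤length B (meetsEveryColumn (_∈? B) ¬miss))

module Shapes (m r : ℕ) where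

  open WebGraph m r
  open Forcing G

  -- A set of positions (column, level); level 0 holds the pendants.
  Shape : Set₁
  Shape = ℕ → ℕ → Set

  ⟦_⟧ : Shape → Vertex → Set
  ⟦ Sh ⟧ x = Sh (col x) (level x)

  infixr 6 _∪ˢ_

  _∪ˢ_ : Shape → Shape → Shape
  (A ∪ˢ B) c l = A c l ⊎ B c l

  Forceable : Shape → Set₁
  Forceable Sh = ∀ {S} → Decidable S → ⟦ Sh ⟧ ⊆′ S → Completes G S

  Forceable-mono : ∀ {A B : Shape} → (∀ c l → c < m → l ≤ r → A c l → B c l) → Forceable A → Forceable B
  Forceable-mono A⊆B K S? B⊆S = K S? (λ x a → B⊆S x (A⊆B _ _ (toℕ<n (column x)) (level≤r x) a))

  forceShape : ∀ {Sh T : Shape} → (∀ c l → Dec (T c l)) → (∀ w → ⟦ T ⟧ w → Forcer ⟦ Sh ⟧ w) →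
               Forceable (Sh ∪ˢ T) → Forceable Sh
  forceShape T? forcers K S? Sh⊆S =
    forceAll _≟ᵥ_ vertices ∈-vertices S? (λ x → T? (col x) (level x)) Sh⊆S forcers
      (K (S? ∪? (λ x → T? (col x) (level x))) (λ x → Sum.map₁ (Sh⊆S x)))

  data Consecutive : ℕ → ℕ → ℕ → Set where
    ascending  : ∀ {c} → Consecutive c (suc c) (suc (suc c))
    descending : ∀ {c} → Consecutive (suc (suc c)) (suc c) c

  Consecutive-middle≥1 : ∀ {o c t} → Consecutive o c t → 1 ≤ c
  Consecutive-middle≥1 ascending = s≤s z≤n
  Consecutive-middle≥1 descending = s≤s z≤n

  Consecutive-neighbour : ∀ {o c t x} → Consecutive o c t → x ≡ suc c ⊎ suc x ≡ c → x ≡ o ⊎ x ≡ t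
  Consecutive-neighbour ascending (inj₁ x≡) = inj₂ x≡
  Consecutive-neighbour ascending (inj₂ sx≡) = inj₁ (suc-injective sx≡)
  Consecutive-neighbour descending (inj₁ x≡) = inj₁ x≡
  Consecutive-neighbour descending (inj₂ sx≡) = inj₂ (suc-injective sx≡)

  Consecutive-adj : ∀ {o c t} (i i′ : Fin m) → Consecutive o c t → toℕ i ≡ c → toℕ i′ ≡ t → CycAdj m i i′
  Consecutive-adj i i′ ascending i≡c i′≡t = inj₁ (trans (cong suc i≡c) (sym i′≡t))
  Consecutive-adj i i′ descending i≡c i′≡t = inj₂ (inj₁ (trans (cong suc i′≡t) (sym i≡c)))

  -- v c l forces v t l; its other neighbours are v c (l ± 1) and v o l.
  forceSideways : ∀ {o c t} {Sh : Shape} h → Consecutive o c t → suc c < m → 1 ≤ h →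
    (∀ l → h ≤ l → l ≤ r → Sh o l) → (∀ l → h ≤ suc l → l ≤ r → Sh c l) →
    Forceable (Sh ∪ˢ (λ c′ l → c′ ≡ t × h ≤ l)) → Forceable Sh
  forceSideways {o} {c} {t} {Sh} h dir c+1<m 1≤h o-blue c-blue =
    forceShape {Sh} (λ c′ l → (c′ ≟ℕ t) ×-dec (h ≤? l)) forcer
    where
    ic : Fin m
    ic = fromℕ< (<-trans (n<1+n c) c+1<m)
    ic≡c : toℕ ic ≡ c
    ic≡c = toℕ-fromℕ< _
    sameColumn : ∀ {x} → column x ≡ ic → Sh (toℕ ic) (level x) → ⟦ Sh ⟧ x
    sameColumn {x} x∈ic = subst (λ z → Sh z (level x)) (cong toℕ (sym x∈ic))
    c-blue′ : ∀ l → h ≤ suc l → l ≤ r → Sh (toℕ ic) l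
    c-blue′ l h≤ l≤r = subst (λ z → Sh z l) (sym ic≡c) (c-blue l h≤ l≤r)
    forcer : ∀ w → col w ≡ t × h ≤ level w → Forcer ⟦ Sh ⟧ w
    forcer (inj₂ _) (_ , h≤0) = ⊥-elim (<-irrefl refl (≤-trans 1≤h h≤0))
    forcer (inj₁ (i , j)) (i≡t , h≤l) =
      v ic j , c-blue′ _ (m≤n⇒m≤1+n h≤l) (toℕ<n j) , inj₂ (refl , Consecutive-adj ic i dir ic≡c i≡t) , others
      where
      others : ∀ x → WbAdj m r (v ic j) x → x ≢ v i j → ⟦ Sh ⟧ x
      others x a x≢w with neighbour (v ic j) x a
      ... | above x∈ic l≡ = sameColumn x∈ic (c-blue′ _ (subst (λ z → h ≤ suc z) (sym l≡) (m≤n⇒m≤1+n (m≤n⇒m≤1+n h≤l))) (level≤r x))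
      ... | below x∈ic l≡ = sameColumn x∈ic (c-blue′ _ (subst (h ≤_) (sym l≡) h≤l) (level≤r x))
      ... | sideways l≡ adj
        with Consecutive-neighbour dir (Sum.map (_⟨ trans ⟩ cong suc ic≡c) (_⟨ trans ⟩ ic≡c)
               (cycAdj-interior ic (column x) adj (subst (1 ≤_) (sym ic≡c) (Consecutive-middle≥1 dir)) (subst (λ z → suc z < m) (sym ic≡c) c+1<m)))
      ...   | inj₁ x≡o = subst (λ z → Sh z (level x)) (sym x≡o) (o-blue _ (subst (h ≤_) (sym l≡) h≤l) (level≤r x))
      ...   | inj₂ x≡t = ⊥-elim (x≢w (position-injective x (v i j) (toℕ-injective (trans x≡t (sym i≡t))) l≡))

  forceUp : ∀ {Sh : Shape} l lo hi → 1 ≤ lo → suc hi < m →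
    (∀ c → lo ≤ suc c → c ≤ suc hi → suc l ≤ r → Sh c (suc l)) → (∀ c → lo ≤ c → c ≤ hi → l ≤ r → Sh c l) →
    Forceable (Sh ∪ˢ (λ c l′ → (lo ≤ c × c ≤ hi) × l′ ≡ suc (suc l))) → Forceable Sh
  forceUp {Sh} l lo hi 1≤lo hi+1<m row-blue below-blue =
    forceShape {Sh} (λ c l′ → ((lo ≤? c) ×-dec (c ≤? hi)) ×-dec (l′ ≟ℕ suc (suc l))) forcer
    where
    forcer : ∀ w → (lo ≤ col w × col w ≤ hi) × level w ≡ suc (suc l) → Forcer ⟦ Sh ⟧ w
    forcer (inj₂ _) (_ , ())
    forcer (inj₁ (i , j)) ((lo≤i , i≤hi) , j+1≡) = v i j′ , u-blue , inj₁ (refl , inj₁ j′+1≡j) , others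
      where
      j≡ : toℕ j ≡ suc l
      j≡ = suc-injective j+1≡
      l+1≤r : suc l ≤ r
      l+1≤r = <⇒≤ (subst (_< r) j≡ (toℕ<n j))
      j′ : Fin r
      j′ = fromℕ< l+1≤r
      j′≡ : toℕ j′ ≡ l
      j′≡ = toℕ-fromℕ< l+1≤r
      j′+1≡j : suc (toℕ j′) ≡ toℕ j
      j′+1≡j = trans (cong suc j′≡) (sym j≡)
      level≡ : ∀ {x} → level x ≡ suc (level (v i j′)) → level x ≡ suc (suc l)
      level≡ e = trans e (cong (suc ∘ suc) j′≡)
      u-blue : Sh (toℕ i) (suc (toℕ j′))
      u-blue = subst (Sh (toℕ i) ∘ suc) (sym j′≡) (row-blue (toℕ i) (m≤n⇒m≤1+n lo≤i) (m≤n⇒m≤1+n i≤hi) l+1≤r)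
      others : ∀ x → WbAdj m r (v i j′) x → x ≢ v i j → ⟦ Sh ⟧ x
      others x a x≢w with neighbour (v i j′) x a
      ... | above x∈i l≡ = ⊥-elim (x≢w (position-injective x (v i j) x∈i (trans (level≡ l≡) (sym j+1≡))))
      ... | below x∈i l≡ =
        subst₂ Sh (cong toℕ (sym x∈i)) (sym (trans (suc-injective l≡) j′≡))
          (below-blue (toℕ i) lo≤i i≤hi (≤-trans (n≤1+n l) l+1≤r))
      ... | sideways l≡ adj with cycAdj-interior i (column x) adj (≤-trans 1≤lo lo≤i) (≤-trans (s≤s (s≤s i≤hi)) hi+1<m)
      ...   | inj₁ x≡ = subst₂ Sh (sym x≡) (sym (trans l≡ (cong suc j′≡)))
                          (row-blue (suc (toℕ i)) (m≤n⇒m≤1+n (m≤n⇒m≤1+n lo≤i)) (s≤s i≤hi) l+1≤r)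
      ...   | inj₂ x+1≡ = subst (Sh (col x)) (sym (trans l≡ (cong suc j′≡)))
                          (row-blue (col x) (subst (lo ≤_) (sym x+1≡) lo≤i) (≤-trans (n≤1+n (col x)) (≤-trans (≤-reflexive x+1≡) (m≤n⇒m≤1+n i≤hi))) l+1≤r)

  levelsAboveForceable : ∀ H → H ≤ r → Forceable (λ _ l → H ≤ l)
  levelsAboveForceable zero _ _ Sh⊆S = done (λ x → Sh⊆S x z≤n)
  levelsAboveForceable (suc H) H<r =
    forceShape {λ _ l → suc H ≤ l} (λ _ l → l ≟ℕ H) forcer
      (Forceable-mono split (levelsAboveForceable H (<⇒≤ H<r)))
    where
    split : ∀ c l → c < m → l ≤ r → H ≤ l → suc H ≤ l ⊎ l ≡ H
    split _ l _ _ H≤l with H ≟ℕ l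
    ... | yes H≡l = inj₂ (sym H≡l)
    ... | no H≢l = inj₁ (≤∧≢⇒< H≤l H≢l)
    jH : Fin r
    jH = fromℕ< H<r
    jH≡ : toℕ jH ≡ H
    jH≡ = toℕ-fromℕ< H<r
    above-w : ∀ w → level w ≡ H → WbAdj m r (v (column w) jH) w
    above-w (inj₁ _) l≡ = inj₁ (refl , inj₂ (trans l≡ (sym jH≡)))
    above-w (inj₂ _) l≡ = refl , trans jH≡ (sym l≡)
    forcer : ∀ w → level w ≡ H → Forcer (λ x → suc H ≤ level x) w
    forcer w l≡ = v (column w) jH , ≤-reflexive (cong suc (sym jH≡)) , above-w w l≡ , others
      where
      others : ∀ x → WbAdj m r (v (column w) jH) x → x ≢ w → suc H ≤ level x
      others x a x≢w with neighbour (v (column w) jH) x a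
      ... | below x∈ l≡′ = ⊥-elim (x≢w (position-injective x w x∈ (suc-injective (trans l≡′ (cong suc (trans jH≡ (sym l≡)))))))
      ... | above _ l≡′ = ≤-trans (≤-reflexive (cong suc (sym jH≡))) (≤-trans (n≤1+n _) (≤-reflexive (sym l≡′)))
      ... | sideways l≡′ _ = ≤-reflexive (sym (trans l≡′ (cong suc jH≡)))

  levelsBelowForceable : ∀ d L → d + L ≡ r → Forceable (λ _ l → l ≤ L)
  levelsBelowForceable zero _ refl _ Sh⊆S = done (λ x → Sh⊆S x (level≤r x))
  levelsBelowForceable (suc d) L d+1+L≡r =
    forceShape {λ _ l → l ≤ L} (λ _ l → l ≟ℕ suc L) forcer
      (Forceable-mono split (levelsBelowForceable d (suc L) (trans (+-suc d L) d+1+L≡r)))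
    where
    split : ∀ c l → c < m → l ≤ r → l ≤ suc L → l ≤ L ⊎ l ≡ suc L
    split _ l _ _ l≤L+1 with l ≟ℕ suc L
    ... | yes l≡ = inj₂ l≡
    ... | no l≢ = inj₁ (≤-pred (≤∧≢⇒< l≤L+1 l≢))
    forcer : ∀ w → level w ≡ suc L → Forcer (λ x → level x ≤ L) w
    forcer (inj₂ _) ()
    forcer (inj₁ (i , Fin.zero)) _ =
      p i , z≤n , (refl , refl) , (λ x a x≢w → ⊥-elim (x≢w (pendant-neighbour-unique i a (refl , refl))))
    forcer (inj₁ (i , Fin.suc j)) j+2≡ = v i (inject₁ j) , ≤-reflexive (trans (cong suc (toℕ-inject₁ j)) (suc-injective j+2≡)) ,
                                            inj₁ (refl , inj₁ (cong suc (toℕ-inject₁ j))) , others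
      where
      others : ∀ x → WbAdj m r (v i (inject₁ j)) x → x ≢ v i (Fin.suc j) → level x ≤ L
      others x a x≢w with neighbour (v i (inject₁ j)) x a
      ... | above x∈i l≡ = ⊥-elim (x≢w (position-injective x (v i (Fin.suc j)) x∈i (trans l≡ (cong (suc ∘ suc) (toℕ-inject₁ j)))))
      ... | below _ l≡ = ≤-trans (≤-reflexive (trans (suc-injective l≡) (toℕ-inject₁ j))) (≤-trans (n≤1+n _) (≤-reflexive (suc-injective j+2≡)))
      ... | sideways l≡ _ = ≤-reflexive (trans l≡ (trans (cong suc (toℕ-inject₁ j)) (suc-injective j+2≡)))

  forceFromPendants : ∀ {S} → Decidable S → Completes G (λ x → S x ⊎ (level x ≡ 1 × S (p (column x)))) → Completes G S
  forceFromPendants {S} S? = forceAll _≟ᵥ_ vertices ∈-vertices S? T? (λ _ → id) forcer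
    where
    T? : Decidable (λ x → level x ≡ 1 × S (p (column x)))
    T? x = (level x ≟ℕ 1) ×-dec S? (p (column x))
    forcer : ∀ w → level w ≡ 1 × S (p (column w)) → Forcer S w
    forcer (inj₂ _) (() , _)
    forcer (inj₁ (_ , Fin.suc _)) (() , _)
    forcer (inj₁ (i , Fin.zero)) (_ , s) =
      p i , s , (refl , refl) , (λ x a x≢w → ⊥-elim (x≢w (pendant-neighbour-unique i a (refl , refl))))

-- Sideways forcing outwards from the rectangle starts one level higher with each column, so the D ≤ r
-- columns to its right and the a ≤ r columns to its left are reached at the top level; the top row
-- then forces everything below it.
module FromRectangle (m r a Xp D : ℕ) (1≤a : 1 ≤ a) (a≤r : a ≤ r) (a≤Xp : a ≤ Xp)
                     (X+D : suc (suc Xp + D) ≡ m) (D≤r : D ≤ r) where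

  open Shapes m r

  X : ℕ
  X = suc Xp

  Rectangle : Shape
  Rectangle c l = (a ≤ c × c ≤ X × 1 ≤ l) ⊎ (l ≡ 0 × (c ≡ a ⊎ c ≡ X))

  RightTriangle : ℕ → Shape
  RightTriangle d c l = X < c × c ≤ X + d × c ≤ X + l

  LeftTriangle : ℕ → Shape
  LeftTriangle t c l = t ≤ c × c < a × a ≤ c + l

  rectangleOrRight : ∀ d c l → a ≤ c → c ≤ X + d → c ≤ X + l → 1 ≤ l → (Rectangle ∪ˢ RightTriangle d) c l
  rectangleOrRight d c l a≤c c≤X+d c≤X+l 1≤l with c ≤? X
  ... | yes c≤X = inj₁ (inj₁ (a≤c , c≤X , 1≤l))
  ... | no c≰X = inj₂ (≰⇒> c≰X , c≤X+d , c≤X+l)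

  topRow : Forceable ((Rectangle ∪ˢ RightTriangle D) ∪ˢ LeftTriangle 0)
  topRow = Forceable-mono top (levelsAboveForceable r ≤-refl)
    where
    top : ∀ c l → c < m → l ≤ r → r ≤ l → ((Rectangle ∪ˢ RightTriangle D) ∪ˢ LeftTriangle 0) c l
    top c l c<m _ r≤l with c <? a
    ... | yes c<a = inj₂ (z≤n , c<a , ≤-trans a≤r (≤-trans r≤l (m≤n+m l c)))
    ... | no c≮a = inj₁ (rectangleOrRight D c l (≮⇒≥ c≮a) c≤X+D (≤-trans c≤X+D (+-monoʳ-≤ X (≤-trans D≤r r≤l)))
                                         (≤-trans 1≤a (≤-trans a≤r r≤l)))
      where
      c≤X+D : c ≤ X + D
      c≤X+D = ≤-pred (subst (c <_) (sym X+D) c<m)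

  leftSource : ∀ c h l → c + h ≡ a → h ≤ l → ((Rectangle ∪ˢ RightTriangle D) ∪ˢ LeftTriangle c) c l
  leftSource c zero zero c+0≡a _ = inj₁ (inj₁ (inj₂ (refl , inj₁ (trans (sym (+-identityʳ c)) c+0≡a))))
  leftSource c zero (suc _) c+0≡a _ =
    inj₁ (inj₁ (inj₁ (≤-reflexive (sym c≡a) , ≤-trans (≤-reflexive c≡a) (≤-trans a≤Xp (n≤1+n _)) , s≤s z≤n)))
    where
    c≡a : c ≡ a
    c≡a = trans (sym (+-identityʳ c)) c+0≡a
  leftSource c (suc h) l c+h+1≡a h+1≤l =
    inj₂ (≤-refl , subst (c <_) c+h+1≡a (≤-trans (≤-reflexive (sym (+-suc c 0 ⟨ trans ⟩ cong suc (+-identityʳ c)))) (+-monoʳ-≤ c (s≤s z≤n))) ,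
          ≤-trans (≤-reflexive (sym c+h+1≡a)) (+-monoʳ-≤ c h+1≤l))

  leftTriangle : ∀ t h → t + h ≡ a → Forceable ((Rectangle ∪ˢ RightTriangle D) ∪ˢ LeftTriangle t)
  leftTriangle zero h _ = topRow
  leftTriangle (suc t) h t+1+h≡a =
    forceSideways {Sh = (Rectangle ∪ˢ RightTriangle D) ∪ˢ LeftTriangle (suc t)} (suc h) descending t+2<m (s≤s z≤n) other-blue (λ l h+1≤ _ → leftSource (suc t) h l t+1+h≡a (≤-pred h+1≤))
      (Forceable-mono extend (leftTriangle t (suc h) (trans (+-suc t h) t+1+h≡a)))
    where
    t+1≤a : suc t ≤ a
    t+1≤a = subst (suc t ≤_) t+1+h≡a (m≤m+n (suc t) h)
    t+2<m : suc (suc t) < m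
    t+2<m = ≤-trans (s≤s (s≤s (≤-trans t+1≤a a≤Xp))) (subst (suc (suc Xp) ≤_) X+D (m≤m+n (suc (suc Xp)) D))
    other-blue : ∀ l → suc h ≤ l → l ≤ r → ((Rectangle ∪ˢ RightTriangle D) ∪ˢ LeftTriangle (suc t)) (suc (suc t)) l
    other-blue l h+1≤l _ with suc (suc t) <? a
    ... | yes t+2<a = inj₂ (n≤1+n _ , t+2<a , ≤-trans (≤-reflexive (sym t+1+h≡a))
                                                (≤-trans (+-monoʳ-≤ (suc t) (≤-trans (n≤1+n h) h+1≤l)) (+-monoˡ-≤ l (n≤1+n _))))
    ... | no t+2≮a = inj₁ (inj₁ (inj₁ (≮⇒≥ t+2≮a , s≤s (≤-trans t+1≤a a≤Xp) , ≤-trans (s≤s z≤n) h+1≤l)))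
    extend : ∀ c l → c < m → l ≤ r → ((Rectangle ∪ˢ RightTriangle D) ∪ˢ LeftTriangle t) c l →
             (((Rectangle ∪ˢ RightTriangle D) ∪ˢ LeftTriangle (suc t)) ∪ˢ (λ c′ l′ → c′ ≡ t × suc h ≤ l′)) c l
    extend c l _ _ (inj₁ old) = inj₁ (inj₁ old)
    extend c l _ _ (inj₂ (t≤c , c<a , a≤c+l)) with t ≟ℕ c
    ... | yes refl = inj₂ (refl , +-cancelˡ-≤ t (suc h) l (subst (_≤ t + l) (sym (trans (+-suc t h) t+1+h≡a)) a≤c+l))
    ... | no t≢c = inj₁ (inj₂ (≤∧≢⇒< t≤c t≢c , c<a , a≤c+l))

  rightTriangle : ∀ k d → k + d ≡ D → Forceable (Rectangle ∪ˢ RightTriangle d)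
  rightTriangle zero d 0+d≡D = Forceable-mono shrink (leftTriangle a 0 (+-identityʳ a))
    where
    shrink : ∀ c l → c < m → l ≤ r → ((Rectangle ∪ˢ RightTriangle D) ∪ˢ LeftTriangle a) c l → (Rectangle ∪ˢ RightTriangle d) c l
    shrink c l _ _ (inj₁ (inj₁ rect)) = inj₁ rect
    shrink c l _ _ (inj₁ (inj₂ right)) = inj₂ (subst (λ z → RightTriangle z c l) (sym 0+d≡D) right)
    shrink c l _ _ (inj₂ (a≤c , c<a , _)) = ⊥-elim (<-irrefl refl (≤-trans c<a a≤c))
  rightTriangle (suc k) d k+1+d≡D =
    forceSideways {Sh = Rectangle ∪ˢ RightTriangle d} (suc d) ascending X+d+1<m (s≤s z≤n) other-blue source-blue
      (Forceable-mono extend (rightTriangle k (suc d) (trans (+-suc k d) k+1+d≡D)))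
    where
    d+1≤D : suc d ≤ D
    d+1≤D = subst (suc d ≤_) k+1+d≡D (s≤s (m≤n+m d k))
    X+d+1<m : suc (suc (Xp + d)) < m
    X+d+1<m = subst (suc (suc (suc (Xp + d))) ≤_) X+D (s≤s (s≤s (≤-trans (≤-reflexive (sym (+-suc Xp d))) (+-monoʳ-≤ Xp d+1≤D))))
    other-blue : ∀ l → suc d ≤ l → l ≤ r → (Rectangle ∪ˢ RightTriangle d) (Xp + d) l
    other-blue l d+1≤l _ = rectangleOrRight d (Xp + d) l (≤-trans a≤Xp (m≤m+n Xp d)) (n≤1+n _)
                             (≤-trans (+-monoʳ-≤ Xp (≤-trans (n≤1+n d) d+1≤l)) (n≤1+n _)) (≤-trans (s≤s z≤n) d+1≤l)
    source-blue : ∀ l → suc d ≤ suc l → l ≤ r → (Rectangle ∪ˢ RightTriangle d) (suc (Xp + d)) l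
    source-blue zero d+1≤1 _ = inj₁ (inj₂ (refl , inj₂ (cong suc (trans (cong (Xp +_) (n≤0⇒n≡0 (≤-pred d+1≤1))) (+-identityʳ Xp)))))
    source-blue (suc l) d+1≤ _ = rectangleOrRight d (suc (Xp + d)) (suc l) (≤-trans a≤Xp (≤-trans (m≤m+n Xp d) (n≤1+n _))) ≤-refl
                                   (s≤s (+-monoʳ-≤ Xp (≤-pred d+1≤))) (s≤s z≤n)
    extend : ∀ c l → c < m → l ≤ r → (Rectangle ∪ˢ RightTriangle (suc d)) c l →
             ((Rectangle ∪ˢ RightTriangle d) ∪ˢ (λ c′ l′ → c′ ≡ suc (suc (Xp + d)) × suc d ≤ l′)) c l
    extend c l _ _ (inj₁ rect) = inj₁ (inj₁ rect)
    extend c l _ _ (inj₂ (X<c , c≤X+d+1 , c≤X+l)) with c ≤? X + d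
    ... | yes c≤X+d = inj₁ (inj₂ (X<c , c≤X+d , c≤X+l))
    ... | no c≰X+d = inj₂ (c≡ , +-cancelˡ-≤ X (suc d) l (subst (_≤ X + l) c≡X+d+1 c≤X+l))
      where
      c≡X+d+1 : c ≡ X + suc d
      c≡X+d+1 = ≤-antisym c≤X+d+1 (≤-trans (≤-reflexive (+-suc X d)) (≰⇒> c≰X+d))
      c≡ : c ≡ suc (suc (Xp + d))
      c≡ = trans c≡X+d+1 (cong suc (+-suc Xp d))

  rectangleForceable : Forceable Rectangle
  rectangleForceable = Forceable-mono noTriangle (rightTriangle D 0 (+-identityʳ D))
    where
    noTriangle : ∀ c l → c < m → l ≤ r → (Rectangle ∪ˢ RightTriangle 0) c l → Rectangle c l
    noTriangle c l _ _ (inj₁ rect) = rect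
    noTriangle c l _ _ (inj₂ (X<c , c≤X+0 , _)) = ⊥-elim (<-irrefl refl (≤-trans X<c (≤-trans c≤X+0 (≤-reflexive (+-identityʳ X)))))

-- Pendants of the 2r columns a = a′ + 1, …, b = b′ + 1 and of the e columns b + 2, b + 4, …, b + 2e;
-- at most r columns lie beyond the last of them.
record Layout (m r : ℕ) : Set where
  field
    a′ b′ e     : ℕ
    a≤r         : suc a′ ≤ r
    block-width : suc (suc b′) ≡ suc a′ + (r + r)
    extras<m    : suc b′ + (e + e) < m
    gap≤r       : m ≤ suc b′ + (e + e) + suc r

module Construction (m r : ℕ) (layout : Layout m r) where

  open Layout layout
  open WebGraph m r
  open Shapes m r

  a : ℕ
  a = suc a′

  b : ℕ
  b = suc b′

  1≤r : 1 ≤ r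
  1≤r = ≤-trans (s≤s z≤n) a≤r

  a≤b′ : a ≤ b′
  a≤b′ = ≤-pred (≤-pred (begin
    suc (suc a)   ≡⟨ cong suc (+-comm 1 a) ⟩
    suc (a + 1)   ≡⟨ +-comm 1 (a + 1) ⟨ trans ⟩ +-assoc a 1 1 ⟩
    a + 2         ≤⟨ +-monoʳ-≤ a (+-mono-≤ 1≤r 1≤r) ⟩
    a + (r + r)   ≡⟨ sym block-width ⟩
    suc (suc b′)  ∎))
    where open ≤-Reasoning

  b<m : b < m
  b<m = ≤-trans (s≤s (m≤m+n b (e + e))) extras<m

  Rect : ℕ → ℕ → Shape
  Rect lo hi c l = lo ≤ c × c ≤ hi × 1 ≤ l

  PendantAt : ℕ → Shape
  PendantAt c₀ c l = l ≡ 0 × c ≡ c₀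

  extraColumn : ℕ → ℕ
  extraColumn t = b + suc (suc (t + t))

  BlockPendants : Shape
  BlockPendants c l = l ≡ 0 × a ≤ c × c ≤ b

  Extras : Shape
  Extras c l = l ≤ 1 × ∃[ t ] t < e × c ≡ extraColumn t

  Seeds : Shape
  Seeds = BlockPendants ∪ˢ Extras

  frontier : ℕ → ℕ
  frontier t = b + (t + t)

  Swept : ℕ → Shape
  Swept t = Rect a (frontier t) ∪ˢ PendantAt (frontier t)

  frontier-suc : ∀ t → frontier (suc t) ≡ suc (suc (frontier t))
  frontier-suc t = trans (cong (b +_) (cong suc (+-suc t t))) (trans (+-suc b (suc (t + t))) (cong suc (+-suc b (t + t))))

  extraColumn≡ : ∀ t → extraColumn t ≡ suc (suc (frontier t))
  extraColumn≡ t = trans (+-suc b (suc (t + t))) (cong suc (+-suc b (t + t)))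

  frontier+2<m : ∀ t → suc t ≤ e → suc (suc (frontier t)) < m
  frontier+2<m t t<e = ≤-trans (s≤s (≤-reflexive (sym (extraColumn≡ t)))) (≤-trans (s≤s (+-monoʳ-≤ b 2t+2≤2e)) extras<m)
    where
    2t+2≤2e : suc (suc (t + t)) ≤ e + e
    2t+2≤2e = ≤-trans (≤-reflexive (cong suc (sym (+-suc t t)))) (+-mono-≤ t<e t<e)

  a≤frontier : ∀ t → a ≤ frontier t
  a≤frontier t = ≤-trans a≤b′ (≤-trans (n≤1+n b′) (m≤m+n b (t + t)))

  -- Column frontier t (with its pendant) forces the next column at levels ≥ 1, which in turn forces
  -- the extra column frontier t + 2 at levels ≥ 2; its levels 0 and 1 are already blue.
  sweepStep : ∀ t → suc t ≤ e → Forceable (Seeds ∪ˢ Swept (suc t)) → Forceable (Seeds ∪ˢ Swept t)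
  sweepStep t t<e K =
    forceSideways {Sh = Seeds ∪ˢ Swept t} 1 ascending (<-trans (n<1+n _) f+2<m) ≤-refl left-blue frontier-blue
      (forceSideways {Sh = (Seeds ∪ˢ Swept t) ∪ˢ NextColumn} 2 ascending f+2<m (s≤s z≤n) frontier-blue′ next-blue
        (Forceable-mono extend K))
    where
    f : ℕ
    f = frontier t
    f+2<m : suc (suc f) < m
    f+2<m = frontier+2<m t t<e
    NextColumn : Shape
    NextColumn c l = c ≡ suc f × 1 ≤ l
    left-blue : ∀ l → 1 ≤ l → l ≤ r → (Seeds ∪ˢ Swept t) (b′ + (t + t)) l
    left-blue l 1≤l _ = inj₂ (inj₁ (≤-trans a≤b′ (m≤m+n b′ (t + t)) , n≤1+n _ , 1≤l))
    frontier-blue : ∀ l → 1 ≤ suc l → l ≤ r → (Seeds ∪ˢ Swept t) f l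
    frontier-blue zero _ _ = inj₂ (inj₂ (refl , refl))
    frontier-blue (suc l) _ _ = inj₂ (inj₁ (a≤frontier t , ≤-refl , s≤s z≤n))
    frontier-blue′ : ∀ l → 2 ≤ l → l ≤ r → ((Seeds ∪ˢ Swept t) ∪ˢ NextColumn) f l
    frontier-blue′ l 2≤l _ = inj₁ (inj₂ (inj₁ (a≤frontier t , ≤-refl , ≤-trans (s≤s z≤n) 2≤l)))
    next-blue : ∀ l → 2 ≤ suc l → l ≤ r → ((Seeds ∪ˢ Swept t) ∪ˢ NextColumn) (suc f) l
    next-blue l 2≤l+1 _ = inj₂ (refl , ≤-pred 2≤l+1)
    extend : ∀ c l → c < m → l ≤ r → (Seeds ∪ˢ Swept (suc t)) c l →
             (((Seeds ∪ˢ Swept t) ∪ˢ NextColumn) ∪ˢ (λ c′ l′ → c′ ≡ suc (suc f) × 2 ≤ l′)) c l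
    extend c l _ _ (inj₁ seed) = inj₁ (inj₁ (inj₁ seed))
    extend c l _ _ (inj₂ (inj₂ (l≡0 , c≡))) =
      inj₁ (inj₁ (inj₁ (inj₂ (subst (_≤ 1) (sym l≡0) z≤n , t , t<e , trans c≡ (trans (frontier-suc t) (sym (extraColumn≡ t)))))))
    extend c l _ _ (inj₂ (inj₁ (a≤c , c≤ , 1≤l))) with c ≤? f
    ... | yes c≤f = inj₁ (inj₁ (inj₂ (inj₁ (a≤c , c≤f , 1≤l))))
    ... | no c≰f with c ≟ℕ suc f
    ...   | yes c≡f+1 = inj₁ (inj₂ (c≡f+1 , 1≤l))
    ...   | no c≢f+1 = lastColumn l 1≤l (≤-antisym (subst (c ≤_) (frontier-suc t) c≤) (≤∧≢⇒< (≰⇒> c≰f) (c≢f+1 ∘ sym)))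
      where
      lastColumn : ∀ l → 1 ≤ l → c ≡ suc (suc f) →
                   (((Seeds ∪ˢ Swept t) ∪ˢ NextColumn) ∪ˢ (λ c′ l′ → c′ ≡ suc (suc f) × 2 ≤ l′)) c l
      lastColumn (suc zero) _ c≡ = inj₁ (inj₁ (inj₁ (inj₂ (≤-refl , t , t<e , trans c≡ (sym (extraColumn≡ t))))))
      lastColumn (suc (suc _)) _ c≡ = inj₂ (c≡ , s≤s (s≤s z≤n))

  sweep : ∀ k t → k + t ≡ e → Forceable (Seeds ∪ˢ Swept e) → Forceable (Seeds ∪ˢ Swept t)
  sweep zero t refl K = K
  sweep (suc k) t k+1+t≡e K =
    sweepStep t (subst (suc t ≤_) k+1+t≡e (s≤s (m≤n+m t k))) (sweep k (suc t) (trans (+-suc k t) k+1+t≡e) K)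

  Xp : ℕ
  Xp = b′ + (e + e)

  D : ℕ
  D = m ∸ suc (suc Xp)

  X+D≡m : suc (suc Xp + D) ≡ m
  X+D≡m = m+[n∸m]≡n extras<m

  D≤r : D ≤ r
  D≤r = ≤-trans (∸-monoˡ-≤ (suc (suc Xp)) (≤-trans gap≤r (≤-reflexive (+-suc (suc Xp) r)))) (≤-reflexive (m+n∸m≡n (suc (suc Xp)) r))

  afterSweep : Forceable (Seeds ∪ˢ Swept e)
  afterSweep = Forceable-mono fromRectangle R.rectangleForceable
    where
    module R = FromRectangle m r a Xp D (s≤s z≤n) a≤r (≤-trans a≤b′ (m≤m+n b′ (e + e))) X+D≡m D≤r
    fromRectangle : ∀ c l → c < m → l ≤ r → R.Rectangle c l → (Seeds ∪ˢ Swept e) c l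
    fromRectangle c l _ _ (inj₁ rect) = inj₂ (inj₁ rect)
    fromRectangle c l _ _ (inj₂ (l≡0 , inj₁ refl)) = inj₁ (inj₁ (l≡0 , ≤-refl , ≤-trans a≤b′ (n≤1+n _)))
    fromRectangle c l _ _ (inj₂ (l≡0 , inj₂ refl)) = inj₂ (inj₂ (l≡0 , refl))

  Pyramid : ℕ → Shape
  Pyramid L c l = 1 ≤ l × l ≤ L × a + l ≤ suc c × c + l ≤ suc b

  r≤b : r ≤ b
  r≤b = ≤-pred (≤-trans (+-mono-≤ (s≤s (z≤n {a′})) (m≤m+n r r)) (≤-reflexive (sym block-width)))

  pyramidBelow : ∀ l hi → hi + suc l ≡ b → ∀ c → a + suc l ≤ c → c ≤ hi → (Seeds ∪ˢ Pyramid (suc l)) c l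
  pyramidBelow zero hi hi+1≡b c a+1≤c c≤hi =
    inj₁ (inj₁ (refl , ≤-trans (m≤m+n a 1) a+1≤c , ≤-trans c≤hi (≤-trans (m≤m+n hi 1) (≤-reflexive hi+1≡b))))
  pyramidBelow (suc l) hi hi+l+2≡b c a+l+2≤c c≤hi =
    inj₂ (s≤s z≤n , n≤1+n _ , ≤-trans (+-monoʳ-≤ a (n≤1+n _)) (≤-trans a+l+2≤c (n≤1+n c)) ,
          ≤-trans (+-monoʳ-≤ c (n≤1+n _)) (≤-trans (+-monoˡ-≤ (suc (suc l)) c≤hi) (≤-trans (≤-reflexive hi+l+2≡b) (n≤1+n _))))

  pyramidStep : ∀ l → suc l < r → Forceable (Seeds ∪ˢ Pyramid (suc (suc l))) → Forceable (Seeds ∪ˢ Pyramid (suc l))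
  pyramidStep l l+1<r K =
    forceUp {Sh = Seeds ∪ˢ Pyramid (suc l)} l (a + suc l) hi (s≤s z≤n) hi+1<m row-blue
      (λ c a+l+1≤c c≤hi _ → pyramidBelow l hi hi+l+1≡b c a+l+1≤c c≤hi) (Forceable-mono extend K)
    where
    hi : ℕ
    hi = b ∸ suc l
    hi+l+1≡b : hi + suc l ≡ b
    hi+l+1≡b = m∸n+n≡m (≤-trans (<⇒≤ l+1<r) r≤b)
    hi+1<m : suc hi < m
    hi+1<m = ≤-trans (s≤s (≤-trans (s≤s (m≤m+n hi l)) (≤-reflexive (trans (sym (+-suc hi l)) hi+l+1≡b)))) b<m
    row-blue : ∀ c → a + suc l ≤ suc c → c ≤ suc hi → suc l ≤ r → (Seeds ∪ˢ Pyramid (suc l)) c (suc l)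
    row-blue c a+l+1≤ c≤ _ = inj₂ (s≤s z≤n , ≤-refl , a+l+1≤ , ≤-trans (+-monoˡ-≤ (suc l) c≤) (≤-reflexive (cong suc hi+l+1≡b)))
    extend : ∀ c l′ → c < m → l′ ≤ r → (Seeds ∪ˢ Pyramid (suc (suc l))) c l′ →
             ((Seeds ∪ˢ Pyramid (suc l)) ∪ˢ (λ c′ l″ → (a + suc l ≤ c′ × c′ ≤ hi) × l″ ≡ suc (suc l))) c l′
    extend c l′ _ _ (inj₁ seed) = inj₁ (inj₁ seed)
    extend c l′ _ _ (inj₂ (1≤l′ , l′≤ , a+l′≤ , c+l′≤)) with l′ ≤? suc l
    ... | yes l′≤l+1 = inj₁ (inj₂ (1≤l′ , l′≤l+1 , a+l′≤ , c+l′≤))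
    ... | no l′≰l+1 =
      inj₂ ((≤-pred (≤-trans (≤-reflexive (sym (+-suc a (suc l)))) (subst (λ z → a + z ≤ suc c) l′≡ a+l′≤)) ,
             ≤-trans (≤-reflexive (sym (m+n∸n≡m c (suc l))))
               (∸-monoˡ-≤ (suc l) (≤-pred (≤-trans (≤-reflexive (sym (+-suc c (suc l)))) (subst (λ z → c + z ≤ suc b) l′≡ c+l′≤))))) ,
            l′≡)
      where
      l′≡ : l′ ≡ suc (suc l)
      l′≡ = ≤-antisym l′≤ (≰⇒> l′≰l+1)

  pyramid : ∀ k l → k + suc l ≡ r → Forceable (Seeds ∪ˢ Pyramid r) → Forceable (Seeds ∪ˢ Pyramid (suc l))
  pyramid zero l refl K = K
  pyramid (suc k) l k+l+2≡r K =
    pyramidStep l (subst (suc l <_) k+l+2≡r (s≤s (m≤n+m (suc l) k))) (pyramid k (suc l) (trans (+-suc k (suc l)) k+l+2≡r) K)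

  a+r≤b : a + r ≤ b
  a+r≤b = ≤-pred (≤-trans (≤-reflexive (sym (+-suc a r))) (≤-trans (+-monoʳ-≤ a (+-monoˡ-≤ r 1≤r)) (≤-reflexive (sym block-width))))

  pyramid-level1 : ∀ c → a ≤ c → c ≤ b → Pyramid r c 1
  pyramid-level1 c a≤c c≤b = ≤-refl , 1≤r , ≤-trans (≤-reflexive (+-comm a 1)) (s≤s a≤c) , ≤-trans (≤-reflexive (+-comm c 1)) (s≤s c≤b)

  FilledRight : ℕ → Shape
  FilledRight y = (Seeds ∪ˢ Pyramid r) ∪ˢ Rect (a′ + r) y

  fillRightStep : ∀ y → a′ + r ≤ y → suc y < b → Forceable (FilledRight (suc (suc y))) → Forceable (FilledRight (suc y))
  fillRightStep y a′+r≤y y+1<b K =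
    forceSideways {Sh = FilledRight (suc y)} 2 ascending (≤-trans (s≤s y+1<b) b<m) (s≤s z≤n)
      (λ l 2≤l _ → inj₂ (a′+r≤y , n≤1+n _ , ≤-trans (s≤s z≤n) 2≤l))
      (λ l 2≤l+1 _ → inj₂ (≤-trans a′+r≤y (n≤1+n _) , ≤-refl , ≤-pred 2≤l+1))
      (Forceable-mono extend K)
    where
    extend : ∀ c l → c < m → l ≤ r → FilledRight (suc (suc y)) c l →
             (FilledRight (suc y) ∪ˢ (λ c′ l′ → c′ ≡ suc (suc y) × 2 ≤ l′)) c l
    extend c l _ _ (inj₁ old) = inj₁ (inj₁ old)
    extend c l _ _ (inj₂ (a′+r≤c , c≤ , 1≤l)) with c ≤? suc y
    ... | yes c≤y+1 = inj₁ (inj₂ (a′+r≤c , c≤y+1 , 1≤l))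
    ... | no c≰y+1 = lastColumn l 1≤l (≤-antisym c≤ (≰⇒> c≰y+1))
      where
      lastColumn : ∀ l → 1 ≤ l → c ≡ suc (suc y) → (FilledRight (suc y) ∪ˢ (λ c′ l′ → c′ ≡ suc (suc y) × 2 ≤ l′)) c l
      lastColumn (suc zero) _ c≡ =
        inj₁ (inj₁ (inj₂ (pyramid-level1 c (≤-trans (s≤s (m≤m+n a′ r)) (≤-trans (s≤s a′+r≤y) (≤-trans (n≤1+n _) (≤-reflexive (sym c≡)))))
                                           (≤-trans (≤-reflexive c≡) y+1<b))))
      lastColumn (suc (suc _)) _ c≡ = inj₂ (c≡ , s≤s (s≤s z≤n))

  fillRight : ∀ k y → k + suc y ≡ b → a′ + r ≤ y → Forceable (FilledRight b) → Forceable (FilledRight (suc y))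
  fillRight zero y refl _ K = K
  fillRight (suc k) y k+y+2≡b a′+r≤y K =
    fillRightStep y a′+r≤y (subst (suc y <_) k+y+2≡b (s≤s (m≤n+m (suc y) k)))
      (fillRight k (suc y) (trans (+-suc k (suc y)) k+y+2≡b) (≤-trans a′+r≤y (n≤1+n _)) K)

  FilledLeft : ℕ → Shape
  FilledLeft x = (Seeds ∪ˢ Pyramid r) ∪ˢ Rect x b

  fillLeftStep : ∀ x → a ≤ x → suc x ≤ a′ + r → Forceable (FilledLeft x) → Forceable (FilledLeft (suc x))
  fillLeftStep x a≤x x+1≤ K =
    forceSideways {Sh = FilledLeft (suc x)} 2 descending (≤-trans (s≤s x+2≤b) b<m) (s≤s z≤n)
      (λ l 2≤l _ → inj₂ (n≤1+n _ , x+2≤b , ≤-trans (s≤s z≤n) 2≤l))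
      (λ l 2≤l+1 _ → inj₂ (≤-refl , ≤-trans (n≤1+n _) x+2≤b , ≤-pred 2≤l+1))
      (Forceable-mono extend K)
    where
    x+2≤b : suc (suc x) ≤ b
    x+2≤b = ≤-trans (s≤s x+1≤) a+r≤b
    extend : ∀ c l → c < m → l ≤ r → FilledLeft x c l → (FilledLeft (suc x) ∪ˢ (λ c′ l′ → c′ ≡ x × 2 ≤ l′)) c l
    extend c l _ _ (inj₁ old) = inj₁ (inj₁ old)
    extend c l _ _ (inj₂ (x≤c , c≤b , 1≤l)) with x ≟ℕ c
    ... | no x≢c = inj₁ (inj₂ (≤∧≢⇒< x≤c x≢c , c≤b , 1≤l))
    ... | yes refl = firstColumn l 1≤l
      where
      firstColumn : ∀ l → 1 ≤ l → (FilledLeft (suc x) ∪ˢ (λ c′ l′ → c′ ≡ x × 2 ≤ l′)) x l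
      firstColumn (suc zero) _ = inj₁ (inj₁ (inj₂ (pyramid-level1 x a≤x c≤b)))
      firstColumn (suc (suc _)) _ = inj₂ (refl , s≤s (s≤s z≤n))

  fillLeft : ∀ d → a + d ≤ a′ + r → Forceable (FilledLeft a) → Forceable (FilledLeft (a + d))
  fillLeft zero _ K = subst (Forceable ∘ FilledLeft) (sym (+-identityʳ a)) K
  fillLeft (suc d) a+d+1≤ K = subst (Forceable ∘ FilledLeft) (sym (+-suc a d))
    (fillLeftStep (a + d) (m≤m+n a d) (≤-trans (≤-reflexive (sym (+-suc a d))) a+d+1≤) (fillLeft d (≤-trans (+-monoʳ-≤ a (n≤1+n d)) a+d+1≤) K))

  rectangleFilled : Forceable (FilledLeft a)
  rectangleFilled = Forceable-mono fromSwept (sweep e 0 (+-identityʳ e) afterSweep)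
    where
    fromSwept : ∀ c l → c < m → l ≤ r → (Seeds ∪ˢ Swept 0) c l → FilledLeft a c l
    fromSwept c l _ _ (inj₁ seed) = inj₁ (inj₁ seed)
    fromSwept c l _ _ (inj₂ (inj₁ (a≤c , c≤ , 1≤l))) = inj₂ (a≤c , ≤-trans c≤ (≤-reflexive (+-identityʳ b)) , 1≤l)
    fromSwept c l _ _ (inj₂ (inj₂ (l≡0 , c≡))) =
      inj₁ (inj₁ (inj₁ (l≡0 , ≤-trans (≤-trans a≤b′ (n≤1+n _)) (≤-reflexive (sym (trans c≡ (+-identityʳ b)))) , ≤-reflexive (trans c≡ (+-identityʳ b)))))

  middleFilled : Forceable (FilledRight b)
  middleFilled = subst (Forceable ∘ FilledLeft) a+r-1≡ (fillLeft (r ∸ 1) (≤-reflexive a+r-1≡) rectangleFilled)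
    where
    a+r-1≡ : a + (r ∸ 1) ≡ a′ + r
    a+r-1≡ = trans (sym (+-suc a′ (r ∸ 1))) (cong (a′ +_) (m+[n∸m]≡n 1≤r))

  pyramidTop : Forceable (Seeds ∪ˢ Pyramid r)
  pyramidTop = Forceable-mono fromMiddle (fillRight (b ∸ (a + r)) (a′ + r) (m∸n+n≡m a+r≤b) ≤-refl middleFilled)
    where
    fromMiddle : ∀ c l → c < m → l ≤ r → FilledRight (a + r) c l → (Seeds ∪ˢ Pyramid r) c l
    fromMiddle c l _ _ (inj₁ old) = old
    fromMiddle c l _ l≤r (inj₂ (a′+r≤c , c≤a+r , 1≤l)) =
      inj₂ (1≤l , l≤r , ≤-trans (+-monoʳ-≤ a l≤r) (s≤s a′+r≤c) ,
            ≤-trans (+-mono-≤ c≤a+r l≤r) (≤-trans (≤-reflexive (+-assoc a r r)) (≤-reflexive (sym block-width))))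

  levelOneForceable : Forceable (Seeds ∪ˢ Pyramid 1)
  levelOneForceable = pyramid (r ∸ 1) 0 (m∸n+n≡m 1≤r) pyramidTop

  ExtraPendants : Shape
  ExtraPendants c l = l ≡ 0 × ∃[ t ] t < e × c ≡ extraColumn t

  InitialPendants : Shape
  InitialPendants = BlockPendants ∪ˢ ExtraPendants

  initialPendantsForceable : Forceable InitialPendants
  initialPendantsForceable {S} S? init⊆S =
    forceFromPendants S? (levelOneForceable (S? ∪? (λ x → (level x ≟ℕ 1) ×-dec S? (p (column x)))) levelOne⊆)
    where
    levelOne⊆ : ⟦ Seeds ∪ˢ Pyramid 1 ⟧ ⊆′ (λ x → S x ⊎ (level x ≡ 1 × S (p (column x))))
    levelOne⊆ x (inj₁ (inj₁ block)) = inj₁ (init⊆S x (inj₁ block))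
    levelOne⊆ x (inj₁ (inj₂ (l≤1 , extra))) with level x in l≡
    ... | zero = inj₁ (init⊆S x (inj₂ (l≡ , extra)))
    ... | suc zero = inj₂ (refl , init⊆S (p (column x)) (inj₂ (refl , extra)))
    levelOne⊆ x (inj₁ (inj₂ (s≤s () , _))) | suc (suc _)
    levelOne⊆ x (inj₂ (1≤l , l≤1 , a+l≤ , c+l≤)) = inj₂ (l≡1 , init⊆S (p (column x)) (inj₁ (refl , a≤c , c≤b)))
      where
      l≡1 : level x ≡ 1
      l≡1 = ≤-antisym l≤1 1≤l
      a≤c : a ≤ col x
      a≤c = ≤-pred (≤-trans (≤-reflexive (+-comm 1 a)) (subst (λ z → a + z ≤ suc (col x)) l≡1 a+l≤))
      c≤b : col x ≤ b
      c≤b = ≤-pred (≤-trans (≤-reflexive (+-comm 1 (col x))) (subst (λ z → col x + z ≤ suc b) l≡1 c+l≤))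

  blockColumn : Fin (r + r) → Fin m
  blockColumn s = fromℕ< {a + toℕ s} (≤-trans (+-monoʳ-< a (toℕ<n s)) (≤-trans (≤-reflexive (sym block-width)) b<m))

  extraColumn<m : ∀ (s : Fin e) → extraColumn (toℕ s) < m
  extraColumn<m s = ≤-trans (s≤s (+-monoʳ-≤ b 2s+2≤2e)) extras<m
    where
    2s+2≤2e : suc (suc (toℕ s + toℕ s)) ≤ e + e
    2s+2≤2e = ≤-trans (≤-reflexive (cong suc (sym (+-suc (toℕ s) (toℕ s))))) (+-mono-≤ (toℕ<n s) (toℕ<n s))

  extraColumnᶠ : Fin e → Fin m
  extraColumnᶠ s = fromℕ< (extraColumn<m s)

  pendantColumns : List (Fin m)
  pendantColumns = tabulate blockColumn ++ tabulate extraColumnᶠ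

  pendantSet : List Vertex
  pendantSet = map p pendantColumns

  length-pendantSet : length pendantSet ≡ r + r + e
  length-pendantSet = begin
    length (map p pendantColumns)                          ≡⟨ length-map p pendantColumns ⟩
    length pendantColumns                                  ≡⟨ length-++ (tabulate blockColumn) ⟩
    length (tabulate blockColumn) + length (tabulate extraColumnᶠ) ≡⟨ cong₂ _+_ (length-tabulate blockColumn) (length-tabulate extraColumnᶠ) ⟩
    r + r + e                                              ∎
    where open ≡-Reasoning

  blockColumn-injective : ∀ {s t} → blockColumn s ≡ blockColumn t → s ≡ t
  blockColumn-injective {s} {t} e =
    toℕ-injective (+-cancelˡ-≡ a (toℕ s) (toℕ t) (trans (sym (toℕ-fromℕ< _)) (trans (cong toℕ e) (toℕ-fromℕ< _))))

  double-injective : ∀ x y → x + x ≡ y + y → x ≡ y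
  double-injective zero zero _ = refl
  double-injective (suc x) (suc y) e = cong suc (double-injective x y (suc-injective (trans (sym (+-suc x x)) (trans (suc-injective e) (+-suc y y)))))
  double-injective zero (suc _) ()
  double-injective (suc _) zero ()

  extraColumn-injective : ∀ {s t} → extraColumnᶠ s ≡ extraColumnᶠ t → s ≡ t
  extraColumn-injective {s} {t} e =
    toℕ-injective (double-injective _ _ (suc-injective (suc-injective (+-cancelˡ-≡ b _ _
      (trans (sym (toℕ-fromℕ< (extraColumn<m s))) (trans (cong toℕ e) (toℕ-fromℕ< (extraColumn<m t))))))))

  block≢extra : ∀ s t → blockColumn s ≢ extraColumnᶠ t
  block≢extra s t e = <-irrefl refl (≤-trans (s≤s block≤b) b<extra)
    where
    block≤b : toℕ (blockColumn s) ≤ b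
    block≤b = ≤-pred (subst (_< suc b) (sym (toℕ-fromℕ< _)) (≤-trans (+-monoʳ-< a (toℕ<n s)) (≤-reflexive (sym block-width))))
    b<extra : suc b ≤ toℕ (blockColumn s)
    b<extra = subst (suc b ≤_) (sym (trans (cong toℕ e) (toℕ-fromℕ< (extraColumn<m t))))
                (≤-trans (n≤1+n _) (≤-trans (≤-reflexive (sym (extraColumn≡ 0 ⟨ trans ⟩ cong (suc ∘ suc) (+-identityʳ b)))) (+-monoʳ-≤ b (s≤s (s≤s z≤n)))))

  pendantSet-unique : Unique pendantSet
  pendantSet-unique = Unique.map⁺ inj₂-injective (Unique.++⁺ (Unique.tabulate⁺ blockColumn-injective) (Unique.tabulate⁺ extraColumn-injective) disjoint)
    where
    disjoint : ∀ {c} → ¬ (c ∈ tabulate blockColumn × c ∈ tabulate extraColumnᶠ)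
    disjoint (c∈block , c∈extra) with ∈-tabulate⁻ c∈block | ∈-tabulate⁻ c∈extra
    ... | s , refl | t , e = block≢extra s t e

  initial⊆pendantSet : ⟦ InitialPendants ⟧ ⊆′ (_∈ pendantSet)
  initial⊆pendantSet (inj₁ _) (inj₁ (() , _))
  initial⊆pendantSet (inj₁ _) (inj₂ (() , _))
  initial⊆pendantSet (inj₂ i) (inj₁ (_ , a≤i , i≤b)) =
    ∈-map⁺ p (∈-++⁺ˡ (subst (_∈ tabulate blockColumn) (sym i≡) (∈-tabulate⁺ s)))
    where
    i-a<2r : toℕ i ∸ a < r + r
    i-a<2r = +-cancelʳ-≤ a (suc (toℕ i ∸ a)) (r + r)
               (≤-trans (s≤s (≤-trans (≤-reflexive (m∸n+n≡m a≤i)) i≤b)) (≤-reflexive (trans block-width (+-comm a (r + r)))))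
    s : Fin (r + r)
    s = fromℕ< i-a<2r
    i≡ : i ≡ blockColumn s
    i≡ = toℕ-injective (sym (trans (toℕ-fromℕ< _) (trans (cong (a +_) (toℕ-fromℕ< _)) (m+[n∸m]≡n a≤i))))
  initial⊆pendantSet (inj₂ i) (inj₂ (_ , t , t<e , i≡extra)) =
    ∈-map⁺ p (∈-++⁺ʳ (tabulate blockColumn) (subst (_∈ tabulate extraColumnᶠ) (sym i≡) (∈-tabulate⁺ (fromℕ< t<e))))
    where
    i≡ : i ≡ extraColumnᶠ (fromℕ< t<e)
    i≡ = toℕ-injective (trans i≡extra (sym (trans (toℕ-fromℕ< _) (cong extraColumn (toℕ-fromℕ< t<e)))))

  pendantSet-zfs : IsZFS G pendantSet
  pendantSet-zfs = initialPendantsForceable (_∈? pendantSet) initial⊆pendantSet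
    where open import Data.List.Membership.DecPropositional _≟ᵥ_ using (_∈?_)

shortLayout : ∀ {m} r′ o → suc o ≤ suc r′ → o + suc (suc r′ + suc r′) ≡ m → Layout m (suc r′)
shortLayout r′ o o<r m≡ = record
  { a′ = o ; b′ = o + (r′ + suc r′) ; e = 0 ; a≤r = o<r
  ; block-width = width o r′
  ; extras<m = ≤-reflexive (trans (last o r′) m≡)
  ; gap≤r = ≤-trans (≤-reflexive (sym m≡)) (≤-trans (m≤m+n _ (suc r′)) (≤-reflexive (room o r′))) }
  where
  width : ∀ o r′ → suc (suc (o + (r′ + suc r′))) ≡ suc o + (suc r′ + suc r′)
  width = solve-∀
  last : ∀ o r′ → suc (suc (o + (r′ + suc r′)) + (0 + 0)) ≡ o + suc (suc r′ + suc r′)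
  last = solve-∀
  room : ∀ o r′ → o + suc (suc r′ + suc r′) + suc r′ ≡ suc (o + (r′ + suc r′)) + (0 + 0) + suc (suc r′)
  room = solve-∀

wideLayout : ∀ {m} r′ e → suc r′ + suc r′ + suc r′ + (e + e) ≤ m → m ≤ suc r′ + suc r′ + (suc r′ + suc r′) + (e + e) →
             Layout m (suc r′)
wideLayout r′ e 3r+2e≤m m≤4r+2e = record
  { a′ = r′ ; b′ = r′ + (r′ + suc r′) ; e = e ; a≤r = ≤-refl
  ; block-width = width r′
  ; extras<m = ≤-trans (≤-reflexive (last r′ e)) 3r+2e≤m
  ; gap≤r = ≤-trans m≤4r+2e (≤-reflexive (room r′ e)) }
  where
  width : ∀ r′ → suc (suc (r′ + (r′ + suc r′))) ≡ suc r′ + (suc r′ + suc r′)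
  width = solve-∀
  last : ∀ r′ e → suc (suc (r′ + (r′ + suc r′)) + (e + e)) ≡ suc r′ + suc r′ + suc r′ + (e + e)
  last = solve-∀
  room : ∀ r′ e → suc r′ + suc r′ + (suc r′ + suc r′) + (e + e) ≡ suc (r′ + (r′ + suc r′)) + (e + e) + suc (suc r′)
  room = solve-∀

extrasLayout : ∀ m r′ → ¬ m ≤ suc r′ + suc r′ + (suc r′ + suc r′) →
               Σ (Layout m (suc r′)) λ L → suc r′ + suc r′ + Layout.e L ≡ ⌈ m /2⌉ ⊔ (suc r′ + suc r′)
extrasLayout m r′ m≰4r = wideLayout r′ e 3r+2e≤m m≤4r+2e , trans 2r+e≡h (sym (m≥n⇒m⊔n≡m 2r≤h))
  where
  r : ℕ
  r = suc r′
  h : ℕ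
  h = ⌈ m /2⌉
  2r≤h : r + r ≤ h
  2r≤h = ≮⇒≥ (λ h<2r → m≰4r (≤-trans (n≤⌈n/2⌉+⌈n/2⌉ m) (+-mono-≤ (<⇒≤ h<2r) (<⇒≤ h<2r))))
  e : ℕ
  e = h ∸ (r + r)
  2r+e≡h : r + r + e ≡ h
  2r+e≡h = m+[n∸m]≡n 2r≤h
  regroup : ∀ r e → r + r + r + (e + e) + r ≡ (r + r + e) + (r + r + e)
  regroup = solve-∀
  3r+2e≤m : r + r + r + (e + e) ≤ m
  3r+2e≤m = +-cancelʳ-≤ r _ m (begin
    r + r + r + (e + e) + r     ≡⟨ regroup r e ⟩
    (r + r + e) + (r + r + e)   ≡⟨ cong₂ _+_ 2r+e≡h 2r+e≡h ⟩
    h + h                       ≤⟨ ⌈n/2⌉+⌈n/2⌉≤1+n m ⟩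
    suc m                       ≡⟨ +-comm 1 m ⟩
    m + 1                       ≤⟨ +-monoʳ-≤ m (s≤s z≤n) ⟩
    m + r                       ∎)
    where open ≤-Reasoning
  regroup′ : ∀ r e → (r + r + e) + (r + r + e) ≡ r + r + (r + r) + (e + e)
  regroup′ = solve-∀
  m≤4r+2e : m ≤ r + r + (r + r) + (e + e)
  m≤4r+2e = begin
    m                           ≤⟨ n≤⌈n/2⌉+⌈n/2⌉ m ⟩
    h + h                       ≡⟨ cong₂ _+_ (sym 2r+e≡h) (sym 2r+e≡h) ⟩
    (r + r + e) + (r + r + e)   ≡⟨ regroup′ r e ⟩
    r + r + (r + r) + (e + e)   ∎
    where open ≤-Reasoning

-- For m ≤ 3r the block ends at the last column; otherwise it starts at column r, and extra pendants
-- are needed only when m > 4r.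
chooseLayout : ∀ m r′ → suc r′ + suc r′ < m →
               Σ (Layout m (suc r′)) λ L → suc r′ + suc r′ + Layout.e L ≡ ⌈ m /2⌉ ⊔ (suc r′ + suc r′)
chooseLayout m r′ 2r<m with m ≤? suc r′ + suc r′ + suc r′ | m ≤? suc r′ + suc r′ + (suc r′ + suc r′)
... | yes m≤3r | _ =
  shortLayout r′ (m ∸ suc (r + r)) o<r (m∸n+n≡m 2r<m) , noExtras (≤-trans m≤3r (+-monoʳ-≤ (r + r) (m≤m+n r r)))
  where
  r : ℕ
  r = suc r′
  o<r : suc (m ∸ suc (r + r)) ≤ r
  o<r = +-cancelʳ-≤ (r + r) _ r (begin
    suc (m ∸ suc (r + r)) + (r + r)  ≡⟨ sym (+-suc _ (r + r)) ⟩
    m ∸ suc (r + r) + suc (r + r)    ≡⟨ m∸n+n≡m 2r<m ⟩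
    m                                ≤⟨ m≤3r ⟩
    r + r + r                        ≡⟨ +-comm (r + r) r ⟩
    r + (r + r)                      ∎)
    where open ≤-Reasoning
  noExtras : m ≤ r + r + (r + r) → r + r + 0 ≡ ⌈ m /2⌉ ⊔ (r + r)
  noExtras m≤4r = trans (+-identityʳ (r + r)) (sym (m≤n⇒m⊔n≡n (n≤m+m⇒⌈n/2⌉≤m m≤4r)))
... | no m≰3r | yes m≤4r =
  wideLayout r′ 0 (≤-trans (≤-reflexive (+-identityʳ _)) (<⇒≤ (≰⇒> m≰3r))) (≤-trans m≤4r (≤-reflexive (sym (+-identityʳ _)))) ,
  trans (+-identityʳ (r + r)) (sym (m≤n⇒m⊔n≡n (n≤m+m⇒⌈n/2⌉≤m m≤4r)))
  where
  r : ℕ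
  r = suc r′
... | no _ | no m≰4r = extrasLayout m r′ m≰4r

allPendants : ∀ m r → List (WbV m r)
allPendants m r = map inj₂ (allFin m)

allPendants-zfs : ∀ m r → IsZFS (Web m r) (allPendants m r)
allPendants-zfs m r = levelsBelowForceable r 0 (+-identityʳ r) (_∈? allPendants m r) pendant∈
  where
  open WebGraph m r
  open Shapes m r
  open import Data.List.Membership.DecPropositional _≟ᵥ_ using (_∈?_)
  pendant∈ : ⟦ (λ _ l → l ≤ 0) ⟧ ⊆′ (_∈ allPendants m r)
  pendant∈ (inj₂ i) _ = ∈-map⁺ inj₂ (∈-allFin i)
  pendant∈ (inj₁ _) ()

upperBound : ∀ m r′ → Σ (List (WbV m (suc r′))) λ B →
             Unique B × IsZFS (Web m (suc r′)) B × length B ≡ ⌈ m /2⌉ ⊔ (m ⊓ (2 * suc r′))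
upperBound m r′ with m ≤? 2 * suc r′
... | yes m≤2r =
  allPendants m r , Unique.map⁺ inj₂-injective (Unique.allFin⁺ m) , allPendants-zfs m r ,
  trans (trans (length-map inj₂ (allFin m)) (length-tabulate id))
        (sym (trans (cong (⌈ m /2⌉ ⊔_) (m≤n⇒m⊓n≡m m≤2r)) (m≤n⇒m⊔n≡n (⌈n/2⌉≤n m))))
  where
  r : ℕ
  r = suc r′
... | no m≰2r = pendantSet , pendantSet-unique , pendantSet-zfs ,
  trans length-pendantSet (trans size (cong (⌈ m /2⌉ ⊔_) (sym (trans (m≥n⇒m⊓n≡n (<⇒≤ (≰⇒> m≰2r))) 2r≡r+r))))
  where
  r : ℕ
  r = suc r′
  2r≡r+r : 2 * r ≡ r + r
  2r≡r+r = cong (r +_) (+-identityʳ r)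
  chosen : Σ (Layout m r) λ L → r + r + Layout.e L ≡ ⌈ m /2⌉ ⊔ (r + r)
  chosen = chooseLayout m r′ (subst (_< m) 2r≡r+r (≰⇒> m≰2r))
  size : r + r + Layout.e (proj₁ chosen) ≡ ⌈ m /2⌉ ⊔ (r + r)
  size = proj₂ chosen
  open Construction m r (proj₁ chosen)

mainTheorem2 : (m r : ℕ) → 3 ≤ m → 1 ≤ r →
    ZeroForcingNumber (Web m r) (⌈ m /2⌉ ⊔ (m ⊓ (2 * r)))
mainTheorem2 (suc (suc (suc k))) (suc r′) _ _ = upperBound _ r′ , λ B _ → LowerBound.lowerBound k r′ B
mainTheorem2 (suc (suc (suc _))) zero _ ()
mainTheorem2 (suc (suc zero)) _ (s≤s (s≤s ())) _
mainTheorem2 (suc zero) _ (s≤s ()) _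
mainTheorem2 zero _ () _
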